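{- For every multiply recursive function $f$ there exists a finite TRS $\mathcal{R}$ whose derivational complexity function $\mathrm{dc}_{\mathcal{R}}$ majorises $f$, and such that there exists a proof tree of $\mathcal{R}$ in which every edge label is a reduction pair processor, a dependency graph processor, or a subterm criterion processor (so that termination of $\mathcal{R}$ follows).
   Context: Terms are built over a finite signature and variables; a finite TRS $\mathcal{R}$ is a finite set of rewrite rules; defined symbols are root symbols of left-hand sides; $\to_{\mathcal{R}}$ is the rewrite relation, $\unrhd$ ($\rhd$) the (proper) superterm relation, $|t|$ the size of $t$. $\mathrm{dh}(s,\to)=\max\{n\mid\exists t\, s\to^n t\}$ and $\mathrm{dc}_{\mathcal{R}}(n)=\max\{\mathrm{dh}(t,\to_{\mathcal{R}})\mid |t|\le n\}$. For rule sets $\mathcal{P},\mathcal{S}$, $\to_{\mathcal{P}/\mathcal{S}}={\to_{\mathcal{S}}^*}\cdot{\to_{\mathcal{P}}}\cdot{\to_{\mathcal{S}}^*}$. Dependency pairs: for each defined $f$ of arity $n$ a fresh $f^\sharp$; $t^\sharp=f^\sharp(t_1,\dots,t_n)$ for $t=f(t_1,\dots,t_n)$ and $t^\sharp=t$ for variables; $\mathrm{DP}(\mathcal{R})=\{l^\sharp\to u^\sharp\mid l\to r\in\mathcal{R},\ u\unlhd r,\ u\not\lhd l,\ \text{root of }u\text{ defined}\}$. A DP problem is a pair $(\mathcal{P},\mathcal{R})$ with $\mathcal{P}\subseteq\mathrm{DP}(\mathcal{R})$. Processors: (RP) for a reduction pair $(\succcurlyeq,\succ)$ ($\succcurlyeq$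 a preorder closed under contexts and substitutions, $\succ$ a well-founded order closed under substitutions, ${\succcurlyeq}\cdot{\succ}\cdot{\succcurlyeq}\subseteq{\succ}$), $\Phi((\mathcal{P},\mathcal{R}))=\{(\mathcal{P}',\mathcal{R})\}$ if $\mathcal{P}'\cup\mathcal{R}\subseteq{\succcurlyeq}$ and $\mathcal{P}\setminus\mathcal{P}'\subseteq{\succ}$, else $\{(\mathcal{P},\mathcal{R})\}$; (DG) the dependency graph has nodes $\mathcal{P}$ and an edge from $s\to t$ to $u\to v$ iff $t\sigma\to_{\mathcal{R}}^*u\tau$ for some substitutions $\sigma,\tau$, and $\Phi((\mathcal{P},\mathcal{R}))$ is the set of $(\mathcal{P}',\mathcal{R})$ with $\mathcal{P}'$ a nontrivial strongly connected component (one with at least one nonempty cycle); (SC) for a simple projection $\pi$ (choosing for each $f^\sharp$ an argument index, $\pi(f^\sharp(t_1,\dots,t_n))=t_{\pi(f^\sharp)}$), $\Phi((\mathcal{P},\mathcal{R}))=\{(\mathcal{P}',\mathcal{R})\}$ if $\pi(s)\unrhd\pi(t)$ for all $s\to t\in\mathcal{P}'$ and $\pi(s)\rhd\pi(t)$ for all $s\to t\in\mathcal{P}\setminus\mathcal{P}'$, else $\{(\mathcal{P},\mathcal{R})\}$. A proof tree of $\mathcal{R}$: nodes are DP problems, root $(\mathrm{DP}(\mathcal{R}),\mathcal{R})$, leaves of the form $(\varnothing,\mathcal{R})$, and each inner node $(\mathcal{P},\mathcal{R})$ has a processor $\Phi$ with all elements of $\Phi((\mathcal{P},\mathcal{R}))$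 as children, edges labelled by $\Phi$. Multiply recursive functions: smallest class of functions over $\mathbb{N}$ containing zero functions, successor, projections and the $k$-ary Ackermann functions $A_k$ ($k\ge 2$: $A_k(0,\dots,0,x_k)=x_k+1$, $A_k(\dots,x_{k-1}+1,0)=A_k(\dots,x_{k-1},1)$, $A_k(\dots,x_{k-1}+1,x_k+1)=A_k(\dots,x_{k-1},A_k(\dots,x_{k-1}+1,x_k))$, $A_k(x_1,\dots,x_{i-1},x_i+1,0,\dots,0,x_k)=A_k(x_1,\dots,x_i,x_k,0,\dots,0,x_k)$), closed under composition and primitive recursion. -}

module Defs where

open import Data.Nat using (ℕ; zero; suc; _+_; _≤_; _<_; _⊔_)
open import Data.Fin using (Fin; fromℕ<)
open import Data.Vec using (Vec; []; _∷_; lookup; _[_]≔_; toList)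
open import Data.List using (List; []; _∷_; _++_; replicate)
open import Data.List.Membership.Propositional using (_∈_)
open import Data.Product using (Σ; ∃; _×_; _,_; proj₁; proj₂)
open import Data.Sum using (_⊎_; inj₁; inj₂; [_,_])
open import Relation.Nullary using (¬_)
open import Relation.Binary.PropositionalEquality using (_≡_)
open import Relation.Binary.Construct.Closure.ReflexiveTransitive using (Star)
open import Relation.Binary.Construct.Closure.Transitive using (TransClosure)
open import Induction.WellFounded using (WellFounded)
open import Function using (flip)

-- Graph of the Ackermann functions A_k, all arities k ≥ 2 at once
-- (the argument list has length k; every equation preserves length).
data AckGraph : List ℕ → ℕ → Set where
  ack-base : ∀ m x → AckGraph (replicate (suc m) 0 ++ (x ∷ [])) (suc x)
  ack-zero : ∀ ys a v → AckGraph (ys ++ (a ∷ 1 ∷ [])) v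
           → AckGraph (ys ++ (suc a ∷ 0 ∷ [])) v
  ack-step : ∀ ys a y w v → AckGraph (ys ++ (suc a ∷ y ∷ [])) w
           → AckGraph (ys ++ (a ∷ w ∷ [])) v
           → AckGraph (ys ++ (suc a ∷ suc y ∷ [])) v
  ack-diag : ∀ ys a z x v
           → AckGraph (ys ++ (a ∷ x ∷ (replicate z 0 ++ (x ∷ [])))) v
           → AckGraph (ys ++ (suc a ∷ (replicate (suc z) 0 ++ (x ∷ [])))) v

data MR : ℕ → Set where
  zeroF : ∀ k → MR k
  succF : MR 1
  projF : ∀ {k} → Fin k → MR k
  ackF  : ∀ k → 2 ≤ k → MR k
  compF : ∀ {k m} → MR m → Vec (MR k) m → MR k
  -- primitive recursion on the first argument:
  -- f(0,x̄) = g(x̄),  f(n+1,x̄) = h(n, f(n,x̄), x̄)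
  precF : ∀ {k} → MR k → MR (suc (suc k)) → MR (suc k)

mutual
  data Eval : ∀ {k} → MR k → Vec ℕ k → ℕ → Set where
    ev-zero : ∀ {k} (xs : Vec ℕ k) → Eval (zeroF k) xs 0
    ev-succ : ∀ x → Eval succF (x ∷ []) (suc x)
    ev-proj : ∀ {k} (i : Fin k) xs → Eval (projF i) xs (lookup xs i)
    ev-ack  : ∀ {k} (h : 2 ≤ k) xs y → AckGraph (toList xs) y → Eval (ackF k h) xs y
    ev-comp : ∀ {k m} (h : MR m) (gs : Vec (MR k) m) xs ys y
            → EvalAll gs xs ys → Eval h ys y → Eval (compF h gs) xs y
    ev-prec0 : ∀ {k} (g : MR k) h xs y → Eval g xs y → Eval (precF g h) (0 ∷ xs) y
    ev-precS : ∀ {k} (g : MR k) h n xs y z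
             → Eval (precF g h) (n ∷ xs) y → Eval h (n ∷ y ∷ xs) z
             → Eval (precF g h) (suc n ∷ xs) z

  data EvalAll {k} : ∀ {m} → Vec (MR k) m → Vec ℕ k → Vec ℕ m → Set where
    []  : ∀ xs → EvalAll [] xs []
    _∷_ : ∀ {m g y} {gs : Vec (MR k) m} {xs ys}
        → Eval g xs y → EvalAll gs xs ys → EvalAll (g ∷ gs) xs (y ∷ ys)

record Sig : Set₁ where
  constructor mkSig
  field
    Sym : Set
    ar  : Sym → ℕ
open Sig public

FinSig : (n : ℕ) → (Fin n → ℕ) → Sig
FinSig n a = mkSig (Fin n) a

data Term (S : Sig) : Set where
  var : ℕ → Term S
  fun : (f : Sym S) → Vec (Term S) (ar S f) → Term S

Subst : Sig → Set
Subst S = ℕ → Term S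

mutual
  _·_ : ∀ {S} → Term S → Subst S → Term S
  var x    · σ = σ x
  fun f ts · σ = fun f (ts ·v σ)

  _·v_ : ∀ {S n} → Vec (Term S) n → Subst S → Vec (Term S) n
  []       ·v σ = []
  (t ∷ ts) ·v σ = (t · σ) ∷ (ts ·v σ)

mutual
  size : ∀ {S} → Term S → ℕ
  size (var x)    = 1
  size (fun f ts) = suc (sizes ts)

  sizes : ∀ {S n} → Vec (Term S) n → ℕ
  sizes []       = 0
  sizes (t ∷ ts) = size t + sizes ts

data _⊵_ {S : Sig} : Term S → Term S → Set where
  ⊵-refl : ∀ {t} → t ⊵ t
  ⊵-arg  : ∀ {f ts u} (i : Fin (ar S f)) → lookup ts i ⊵ u → fun f ts ⊵ u

data _⊳_ {S : Sig} : Term S → Term S → Set where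
  ⊳-arg : ∀ {f ts u} (i : Fin (ar S f)) → lookup ts i ⊵ u → fun f ts ⊳ u

data _∈V_ {S : Sig} (x : ℕ) : Term S → Set where
  here : x ∈V var x
  arg  : ∀ {f ts} (i : Fin (ar S f)) → x ∈V lookup ts i → x ∈V fun f ts

Rule : Sig → Set
Rule S = Term S × Term S

IsTRS : ∀ {S} → List (Rule S) → Set
IsTRS {S} R = ∀ {l r} → (l , r) ∈ R →
  (∀ x → ¬ (l ≡ var x)) × (∀ x → x ∈V r → x ∈V l)

data Step {S : Sig} (R : List (Rule S)) : Term S → Term S → Set where
  root : ∀ {l r} → (l , r) ∈ R → (σ : Subst S) → Step R (l · σ) (r · σ)
  cong : ∀ {f ts t} (i : Fin (ar S f)) → Step R (lookup ts i) t
       → Step R (fun f ts) (fun f (ts [ i ]≔ t))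

data Steps {S : Sig} (R : List (Rule S)) : ℕ → Term S → Term S → Set where
  done : ∀ {t} → Steps R 0 t t
  next : ∀ {n s t u} → Step R s t → Steps R n t u → Steps R (suc n) s u

DhAtLeast : ∀ {S} → List (Rule S) → Term S → ℕ → Set
DhAtLeast R t m = ∃ λ u → Steps R m t u

-- m ≤ dc_R(n)  (dc_R(n) = max { dh(t) | |t| ≤ n })
DcAtLeast : ∀ {S} → List (Rule S) → ℕ → ℕ → Set
DcAtLeast R n m = ∃ λ t → size t ≤ n × DhAtLeast R t m

Majorises : ∀ {S k} → List (Rule S) → MR k → Set
Majorises {k = k} R f = ∃ λ N → ∀ n → N ≤ n → ∀ (xs : Vec ℕ k) →
  Data.List.Relation.Unary.All.All (_≤ n) (toList xs) →
  ∀ y → Eval f xs y → DcAtLeast R n y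
  where import Data.List.Relation.Unary.All

Defined : ∀ {S} → List (Rule S) → Sym S → Set
Defined {S} R f = ∃ λ ts → ∃ λ r → (fun f ts , r) ∈ R

RootDefined : ∀ {S} → List (Rule S) → Term S → Set
RootDefined {S} R u = ∃ λ f → ∃ λ (ts : Vec (Term S) (ar S f)) →
  (u ≡ fun f ts) × Defined R f

-- signature extended by marked symbols f♯ (inj₂ f)
♯Sig : Sig → Sig
♯Sig S = mkSig (Sym S ⊎ Sym S) [ ar S , ar S ]

mutual
  emb : ∀ {S} → Term S → Term (♯Sig S)
  emb (var x)    = var x
  emb (fun f ts) = fun (inj₁ f) (embv ts)

  embv : ∀ {S n} → Vec (Term S) n → Vec (Term (♯Sig S)) n
  embv []       = []
  embv (t ∷ ts) = emb t ∷ embv ts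

mark : ∀ {S} → Term S → Term (♯Sig S)
mark (var x)    = var x
mark (fun f ts) = fun (inj₂ f) (embv ts)

embRules : ∀ {S} → List (Rule S) → List (Rule (♯Sig S))
embRules []            = []
embRules ((l , r) ∷ R) = (emb l , emb r) ∷ embRules R

Pair : Sig → Set
Pair S = Term (♯Sig S) × Term (♯Sig S)

PSet : Sig → Set₁
PSet S = Pair S → Set

_⊆P_ : ∀ {S} → PSet S → PSet S → Set
P ⊆P Q = ∀ p → P p → Q p

DP : ∀ {S} → List (Rule S) → PSet S
DP {S} R (s , t) = ∃ λ l → ∃ λ r → ∃ λ u →
  ((l , r) ∈ R) × (r ⊵ u) × ¬ (l ⊳ u) × RootDefined R u ×
  (s ≡ mark l) × (t ≡ mark u)

record ReductionPair (S : Sig) : Set₁ where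
  field
    _≽_ : Term (♯Sig S) → Term (♯Sig S) → Set
    _≻_ : Term (♯Sig S) → Term (♯Sig S) → Set
    ≽-refl  : ∀ {s} → s ≽ s
    ≽-trans : ∀ {s t u} → s ≽ t → t ≽ u → s ≽ u
    ≽-ctx   : ∀ {f ts s t} (i : Fin (ar (♯Sig S) f)) → s ≽ t
            → fun f (ts [ i ]≔ s) ≽ fun f (ts [ i ]≔ t)
    ≽-subst : ∀ {s t} (σ : Subst (♯Sig S)) → s ≽ t → (s · σ) ≽ (t · σ)
    ≻-irrefl : ∀ {s} → ¬ (s ≻ s)
    ≻-trans  : ∀ {s t u} → s ≻ t → t ≻ u → s ≻ u
    ≻-wf     : WellFounded (flip _≻_)
    ≻-subst  : ∀ {s t} (σ : Subst (♯Sig S)) → s ≻ t → (s · σ) ≻ (t · σ)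
    compat   : ∀ {s t u v} → s ≽ t → t ≻ u → u ≽ v → s ≻ v

DGEdge : ∀ {S} → List (Rule S) → Pair S → Pair S → Set
DGEdge {S} R (s , t) (u , v) = ∃ λ (σ : Subst (♯Sig S)) → ∃ λ (τ : Subst (♯Sig S)) →
  Star (Step (embRules R)) (t · σ) (u · τ)

EdgeIn : ∀ {S} → List (Rule S) → PSet S → Pair S → Pair S → Set
EdgeIn R P p q = P p × P q × DGEdge R p q

Path : ∀ {S} → List (Rule S) → PSet S → Pair S → Pair S → Set
Path R P = TransClosure (EdgeIn R P)

NontrivialSCC : ∀ {S} → List (Rule S) → PSet S → PSet S → Set
NontrivialSCC R P P' =
  (P' ⊆P P) ×
  (∀ p q → P' p → P' q → (p ≡ q) ⊎ Path R P p q) ×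
  (∀ p q → P' p → P q → Path R P p q → Path R P q p → P' q) ×
  (∃ λ p → P' p × Path R P p p)

-- simple projection: π f is the chosen argument position of f♯
-- (only meaningful when π f < ar f)
SimpleProj : Sig → Set
SimpleProj S = Sym S → ℕ

data Proj {S : Sig} (π : SimpleProj S) : Term (♯Sig S) → Term (♯Sig S) → Set where
  proj : ∀ {f} (ts : Vec (Term (♯Sig S)) (ar S f)) (h : π f < ar S f)
       → Proj π (fun (inj₂ f) ts) (lookup ts (fromℕ< h))

data ProofTree {S : Sig} (R : List (Rule S)) : PSet S → Set₁ where
  leaf : ∀ {P} → (∀ p → ¬ P p) → ProofTree R P
  rp   : ∀ {P} (P' : PSet S) (rpair : ReductionPair S)
       → P' ⊆P P
       → (∀ s t → P' (s , t) → ReductionPair._≽_ rpair s t)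
       → (∀ l r → (l , r) ∈ R → ReductionPair._≽_ rpair (emb l) (emb r))
       → (∀ s t → P (s , t) → ¬ P' (s , t) → ReductionPair._≻_ rpair s t)
       → ProofTree R P' → ProofTree R P
  dg   : ∀ {P} → (∀ P' → NontrivialSCC R P P' → ProofTree R P')
       → ProofTree R P
  sc   : ∀ {P} (P' : PSet S) (π : SimpleProj S)
       → P' ⊆P P
       → (∀ s t → P' (s , t) → ∃ λ a → ∃ λ b → Proj π s a × Proj π t b × (a ⊵ b))
       → (∀ s t → P (s , t) → ¬ P' (s , t) →
            ∃ λ a → ∃ λ b → Proj π s a × Proj π t b × (a ⊳ b))
       → ProofTree R P' → ProofTree R P

module Submission where

-- The code of f is compiled into rewrite rules over symbols F₀, …, Fₘ of a common arity K.
-- F₀ computes the K-ary Ackermann function, its defining equations read as rules, and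
-- every composition or primitive recursion becomes rules calling the symbols of its
-- subcodes. A start symbol feeds f with arguments nondeterministically chosen below the
-- size n of the start term and then counts the result down, so dc_R(n) ≥ f(x̄).
--
-- Termination: ranking the symbols so that every rule calls only symbols of lower rank,
-- or its own symbol on lexicographically smaller arguments, the interpretation of
-- marked symbols by their rank and of unmarked ones by max is a reduction pair removing
-- all dependency pairs between different symbols. The remaining pairs decrease
-- lexicographically, and the subterm criterion removes them one argument position at
-- a time.

open import Defs renaming (cong to step-arg)
open import Data.Nat using (ℕ; zero; suc; _+_; _∸_; _≤_; _<_; _⊔_; z≤n; s≤s; z<s)
open import Data.Nat.Properties
open import Data.Nat.Induction using (<-wellFounded)
open import Data.Fin as Fin using (Fin; zero; suc; toℕ; fromℕ<)
open import Data.Fin.Properties using (toℕ-fromℕ<; fromℕ<-toℕ; toℕ<n)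
open import Data.Vec using (Vec; []; _∷_; lookup; tabulate; toList; _[_]≔_)
open import Data.Vec.Properties
  using (lookup∘tabulate; tabulate-cong; length-toList; []≔-lookup; []≔-idempotent; lookup∘update)
open import Data.List using (List; []; _∷_; _++_; map; length; replicate; applyUpTo)
open import Data.List.Properties using (length-++; length-replicate; length-applyUpTo; map-++)
open import Data.List.Membership.Propositional using (_∈_)
open import Data.List.Membership.Propositional.Properties using (∈-++⁺ˡ; ∈-++⁺ʳ; ∈-applyUpTo⁺)
open import Data.List.Relation.Binary.Subset.Propositional using (_⊆_)
open import Data.List.Relation.Binary.Pointwise as Pointwise using (Pointwise; []; _∷_)
open import Data.List.Relation.Unary.Any using (here; there)
open import Data.List.Relation.Unary.All as All using (All; []; _∷_)
open import Data.List.Relation.Unary.All.Properties using (++⁺; applyUpTo⁺₁; applyUpTo⁺₂; replicate⁺; map⁺)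
open import Data.Product using (Σ; ∃; ∃₂; _×_; _,_; proj₁; proj₂)
open import Data.Sum using (_⊎_; inj₁; inj₂)
open import Data.Empty using (⊥-elim)
open import Data.Unit using (⊤; tt)
open import Relation.Nullary using (¬_)
open import Relation.Binary.PropositionalEquality
open import Relation.Binary.Construct.Closure.ReflexiveTransitive using (Star; ε; _◅_; _◅◅_)
open import Relation.Binary.Construct.On as On using ()
open import Induction.WellFounded using (WellFounded; module Subrelation)
open import Function using (_∘_)

nth : ∀ {A : Set} → A → List A → ℕ → A
nth d []       j       = d
nth d (x ∷ xs) zero    = x
nth d (x ∷ xs) (suc j) = nth d xs j

module _ {A : Set} (d : A) where

  nth-map : ∀ {B : Set} {d′ : B} (f : A → B) → f d ≡ d′ →
            ∀ xs j → f (nth d xs j) ≡ nth d′ (map f xs) j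
  nth-map f fd []       j       = fd
  nth-map f fd (x ∷ xs) zero    = refl
  nth-map f fd (x ∷ xs) (suc j) = nth-map f fd xs j

  nth-++ˡ : ∀ xs ys j → j < length xs → nth d (xs ++ ys) j ≡ nth d xs j
  nth-++ˡ (x ∷ xs) ys zero    _         = refl
  nth-++ˡ (x ∷ xs) ys (suc j) (s≤s j<n) = nth-++ˡ xs ys j j<n

  nth-length : ∀ xs y ys → nth d (xs ++ y ∷ ys) (length xs) ≡ y
  nth-length []       y ys = refl
  nth-length (x ∷ xs) y ys = nth-length xs y ys

  applyUpTo-nth : ∀ xs → applyUpTo (nth d xs) (length xs) ≡ xs
  applyUpTo-nth []       = refl
  applyUpTo-nth (x ∷ xs) = cong (x ∷_) (applyUpTo-nth xs)

nth-Pointwise : ∀ {A B : Set} {_∼_ : A → B → Set} {d d′ xs ys} →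
                d ∼ d′ → Pointwise _∼_ xs ys → ∀ j → nth d xs j ∼ nth d′ ys j
nth-Pointwise d∼d′ []           j       = d∼d′
nth-Pointwise d∼d′ (x∼y ∷ xs∼ys) zero    = x∼y
nth-Pointwise d∼d′ (x∼y ∷ xs∼ys) (suc j) = nth-Pointwise d∼d′ xs∼ys j

nth-All : ∀ {A : Set} {P : A → Set} {d xs} → P d → All P xs → ∀ j → P (nth d xs j)
nth-All Pd []         j       = Pd
nth-All Pd (px ∷ pxs) zero    = px
nth-All Pd (px ∷ pxs) (suc j) = nth-All Pd pxs j

∈⇒nth : ∀ {A : Set} d {x : A} {xs} → x ∈ xs → ∃ λ j → j < length xs × nth d xs j ≡ x
∈⇒nth d (here refl) = 0 , s≤s z≤n , refl
∈⇒nth d (there x∈)  = let (j , j< , eq) = ∈⇒nth d x∈ in suc j , s≤s j< , eq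

nth-toList : ∀ {A : Set} d {k} (xs : Vec A k) i → nth d (toList xs) (toℕ i) ≡ lookup xs i
nth-toList d (x ∷ xs) zero    = refl
nth-toList d (x ∷ xs) (suc i) = nth-toList d xs i

module Rewriting {S : Sig} (R : List (Rule S)) where

  infix 4 _⟶*_
  _⟶*_ : Term S → Term S → Set
  _⟶*_ = Star (Step R)

  root-step : ∀ {l r s t} → (l , r) ∈ R → (σ : Subst S) → l · σ ≡ s → r · σ ≡ t → Step R s t
  root-step l→r σ refl refl = root l→r σ

  root-step* : ∀ {l r s t} → (l , r) ∈ R → (σ : Subst S) → l · σ ≡ s → r · σ ≡ t → s ⟶* t
  root-step* l→r σ ls≡s rσ≡t = root-step l→r σ ls≡s rσ≡t ◅ ε

  ⟶*-arg : ∀ {f} (ts : Vec (Term S) (ar S f)) i {s t} → lookup ts i ≡ s → s ⟶* t →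
           fun f ts ⟶* fun f (ts [ i ]≔ t)
  ⟶*-arg {f} ts i refl ε = subst (λ us → fun f ts ⟶* fun f us) (sym ([]≔-lookup ts i)) ε
  ⟶*-arg {f} ts i refl (_◅_ {j = s} st sts) =
    step-arg i st ◅ subst (λ us → fun f (ts [ i ]≔ s) ⟶* fun f us) ([]≔-idempotent ts i)
      (⟶*-arg (ts [ i ]≔ s) i (lookup∘update i ts s) sts)

  ⟶*-args : ∀ {n} (g : Vec (Term S) n → Term S) →
            (∀ ts i {t} → lookup ts i ⟶* t → g ts ⟶* g (ts [ i ]≔ t)) →
            ∀ vs ws → (∀ i → lookup vs i ⟶* lookup ws i) → g vs ⟶* g ws
  ⟶*-args g g-arg []       []       _  = ε
  ⟶*-args g g-arg (v ∷ vs) (w ∷ ws) vs⟶ws =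
    g-arg (v ∷ vs) zero (vs⟶ws zero) ◅◅
    ⟶*-args (g ∘ (w ∷_)) (λ ts i → g-arg (w ∷ ts) (suc i)) vs ws (vs⟶ws ∘ suc)

  ⟶*-fun : ∀ f (vs ws : Vec (Term S) (ar S f)) → (∀ i → lookup vs i ⟶* lookup ws i) →
           fun f vs ⟶* fun f ws
  ⟶*-fun f = ⟶*-args (fun f) (λ ts i → ⟶*-arg ts i refl)

  ⟶*⇒Steps : ∀ {s t} → s ⟶* t → ∃ λ n → Steps R n s t
  ⟶*⇒Steps ε          = 0 , done
  ⟶*⇒Steps (st ◅ sts) = suc (proj₁ (⟶*⇒Steps sts)) , next st (proj₂ (⟶*⇒Steps sts))

  Steps-++ : ∀ {a b s t u} → Steps R a s t → Steps R b t u → Steps R (a + b) s u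
  Steps-++ done        q = q
  Steps-++ (next st p) q = next st (Steps-++ p q)

  Steps⇒DhAtLeast : ∀ {n s t} → Steps R n s t → ∀ m → m ≤ n → DhAtLeast R s m
  Steps⇒DhAtLeast p           zero    _         = _ , done
  Steps⇒DhAtLeast (next st p) (suc m) (s≤s m≤n) =
    let (u , q) = Steps⇒DhAtLeast p m m≤n in u , next st q

-- The rank reduction pair

module _ {S : Sig} where

  lookup-embv : ∀ {n} (ts : Vec (Term S) n) i → lookup (embv ts) i ≡ emb (lookup ts i)
  lookup-embv (t ∷ ts) zero    = refl
  lookup-embv (t ∷ ts) (suc i) = lookup-embv ts i

  emb-⊵ : ∀ {t u : Term S} → t ⊵ u → emb t ⊵ emb u
  emb-⊵ ⊵-refl                    = ⊵-refl
  emb-⊵ {fun f ts} (⊵-arg i t⊵u) = ⊵-arg i (subst (_⊵ _) (sym (lookup-embv ts i)) (emb-⊵ t⊵u))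

  emb-⊳ : ∀ {t u : Term S} → t ⊳ u → emb t ⊳ emb u
  emb-⊳ {fun f ts} (⊳-arg i t⊵u) = ⊳-arg i (subst (_⊵ _) (sym (lookup-embv ts i)) (emb-⊵ t⊵u))

module RankPair (S : Sig) (rank : Sym S → ℕ) where

  private
    TS = Term (♯Sig S)

  mutual
    ⟦_⟧ : TS → (ℕ → ℕ) → ℕ
    ⟦ var x ⟧           α = α x
    ⟦ fun (inj₁ f) ts ⟧ α = ⟦ ts ⟧* α
    ⟦ fun (inj₂ f) ts ⟧ α = rank f

    ⟦_⟧* : ∀ {n} → Vec TS n → (ℕ → ℕ) → ℕ
    ⟦ [] ⟧*     α = 0
    ⟦ t ∷ ts ⟧* α = ⟦ t ⟧ α ⊔ ⟦ ts ⟧* α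

  mutual
    ⟦·⟧ : ∀ α σ t → ⟦ t · σ ⟧ α ≡ ⟦ t ⟧ (λ x → ⟦ σ x ⟧ α)
    ⟦·⟧ α σ (var x)           = refl
    ⟦·⟧ α σ (fun (inj₁ f) ts) = ⟦·v⟧ α σ ts
    ⟦·⟧ α σ (fun (inj₂ f) ts) = refl

    ⟦·v⟧ : ∀ {n} α σ (ts : Vec TS n) → ⟦ ts ·v σ ⟧* α ≡ ⟦ ts ⟧* (λ x → ⟦ σ x ⟧ α)
    ⟦·v⟧ α σ []       = refl
    ⟦·v⟧ α σ (t ∷ ts) = cong₂ _⊔_ (⟦·⟧ α σ t) (⟦·v⟧ α σ ts)

  ⟦[]≔⟧-mono : ∀ {n} α (ts : Vec TS n) i s t → ⟦ t ⟧ α ≤ ⟦ s ⟧ α →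
               ⟦ ts [ i ]≔ t ⟧* α ≤ ⟦ ts [ i ]≔ s ⟧* α
  ⟦[]≔⟧-mono α (u ∷ ts) zero    s t t≤s = ⊔-monoˡ-≤ (⟦ ts ⟧* α) t≤s
  ⟦[]≔⟧-mono α (u ∷ ts) (suc i) s t t≤s = ⊔-monoʳ-≤ (⟦ u ⟧ α) (⟦[]≔⟧-mono α ts i s t t≤s)

  _≽_ : TS → TS → Set
  s ≽ t = ∀ α → ⟦ t ⟧ α ≤ ⟦ s ⟧ α

  _≻_ : TS → TS → Set
  s ≻ t = ∀ α → ⟦ t ⟧ α < ⟦ s ⟧ α

  ≻-wellFounded : WellFounded (λ t s → s ≻ t)
  ≻-wellFounded = Subrelation.wellFounded (λ s≻t → s≻t (λ _ → 0))
                    (On.wellFounded (λ t → ⟦ t ⟧ (λ _ → 0)) <-wellFounded)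

  ≽-ctx : ∀ {f ts s t} (i : Fin (ar (♯Sig S) f)) → s ≽ t → fun f (ts [ i ]≔ s) ≽ fun f (ts [ i ]≔ t)
  ≽-ctx {inj₁ f} {ts} {s} {t} i s≽t α = ⟦[]≔⟧-mono α ts i s t (s≽t α)
  ≽-ctx {inj₂ f}              i s≽t α = ≤-refl

  rankPair : ReductionPair S
  rankPair = record
    { _≽_      = _≽_
    ; _≻_      = _≻_
    ; ≽-refl   = λ α → ≤-refl
    ; ≽-trans  = λ s≽t t≽u α → ≤-trans (t≽u α) (s≽t α)
    ; ≽-ctx    = λ {f} {ts} {s} {t} → ≽-ctx {f} {ts} {s} {t}
    ; ≽-subst  = λ {s} {t} σ s≽t α → subst₂ _≤_ (sym (⟦·⟧ α σ t)) (sym (⟦·⟧ α σ s)) (s≽t _)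
    ; ≻-irrefl = λ s≻s → n≮n _ (s≻s (λ _ → 0))
    ; ≻-trans  = λ s≻t t≻u α → <-trans (t≻u α) (s≻t α)
    ; ≻-wf     = ≻-wellFounded
    ; ≻-subst  = λ {s} {t} σ s≻t α → subst₂ _<_ (sym (⟦·⟧ α σ t)) (sym (⟦·⟧ α σ s)) (s≻t _)
    ; compat   = λ s≽t t≻u u≽v α → ≤-<-trans (u≽v α) (<-≤-trans (t≻u α) (s≽t α))
    }

  mutual
    ⟦emb⟧-≥-var : ∀ α {x} (t : Term S) → x ∈V t → α x ≤ ⟦ emb t ⟧ α
    ⟦emb⟧-≥-var α (var x)    here       = ≤-refl
    ⟦emb⟧-≥-var α (fun f ts) (arg i x∈) = ⟦embv⟧-≥-var α ts i x∈

    ⟦embv⟧-≥-var : ∀ α {x n} (ts : Vec (Term S) n) i → x ∈V lookup ts i → α x ≤ ⟦ embv ts ⟧* α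
    ⟦embv⟧-≥-var α (t ∷ ts) zero    x∈ = ≤-trans (⟦emb⟧-≥-var α t x∈) (m≤m⊔n _ _)
    ⟦embv⟧-≥-var α (t ∷ ts) (suc i) x∈ = ≤-trans (⟦embv⟧-≥-var α ts i x∈) (m≤n⊔m _ _)

  mutual
    ⟦emb⟧-≤-vars : ∀ α M (t : Term S) → (∀ x → x ∈V t → α x ≤ M) → ⟦ emb t ⟧ α ≤ M
    ⟦emb⟧-≤-vars α M (var x)    bound = bound x here
    ⟦emb⟧-≤-vars α M (fun f ts) bound = ⟦embv⟧-≤-vars α M ts (λ i x x∈ → bound x (arg i x∈))

    ⟦embv⟧-≤-vars : ∀ α M {n} (ts : Vec (Term S) n) → (∀ i x → x ∈V lookup ts i → α x ≤ M) →
                    ⟦ embv ts ⟧* α ≤ M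
    ⟦embv⟧-≤-vars α M []       bound = z≤n
    ⟦embv⟧-≤-vars α M (t ∷ ts) bound =
      ⊔-lub (⟦emb⟧-≤-vars α M t (bound zero)) (⟦embv⟧-≤-vars α M ts (bound ∘ suc))

  -- Unmarked terms denote the maximum of their variables.
  emb-≽ : ∀ (l r : Term S) → (∀ x → x ∈V r → x ∈V l) → emb l ≽ emb r
  emb-≽ l r vars⊆ α = ⟦emb⟧-≤-vars α (⟦ emb l ⟧ α) r (λ x x∈r → ⟦emb⟧-≥-var α l (vars⊆ x x∈r))

-- Proof trees for rank-lexicographic systems

Lex : ∀ {A : Set} (_>_ : A → A → Set) {n} → ℕ → Vec A n → Vec A n → Set
Lex _>_ {n} j ts us = ∃ λ (i : Fin n) →
  j ≤ toℕ i × (∀ q → q Fin.< i → lookup ts q ≡ lookup us q) × lookup ts i > lookup us i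

data LexList {A : Set} (_>_ : A → A → Set) : List A → List A → Set where
  lex-head : ∀ {x y xs ys} → x > y → LexList _>_ (x ∷ xs) (y ∷ ys)
  lex-tail : ∀ {x xs ys} → LexList _>_ xs ys → LexList _>_ (x ∷ xs) (x ∷ ys)

module _ {A : Set} {_>_ : A → A → Set} where

  LexList-++ : ∀ zs {xs ys} → LexList _>_ xs ys → LexList _>_ (zs ++ xs) (zs ++ ys)
  LexList-++ []       xs>ys = xs>ys
  LexList-++ (z ∷ zs) xs>ys = lex-tail (LexList-++ zs xs>ys)

  LexList⇒nth : ∀ d {xs ys} → LexList _>_ xs ys →
                ∃ λ j → j < length xs × (∀ q → q < j → nth d xs q ≡ nth d ys q) × nth d xs j > nth d ys j
  LexList⇒nth d (lex-head x>y)   = 0 , s≤s z≤n , (λ q ()) , x>y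
  LexList⇒nth d (lex-tail xs>ys) with LexList⇒nth d xs>ys
  ... | j , j< , agree , at = suc j , s≤s j< , agree′ , at
    where
    agree′ : ∀ q → q < suc j → nth d (_ ∷ _) q ≡ nth d (_ ∷ _) q
    agree′ zero    _         = refl
    agree′ (suc q) (s≤s q<j) = agree q q<j

Lex-embv : ∀ {S n j} {ts us : Vec (Term S) n} → Lex _⊳_ j ts us → Lex _⊳_ j (embv ts) (embv us)
Lex-embv {ts = ts} {us} (i , j≤i , agree , ts⊳us) =
  i , j≤i ,
  (λ q q<i → trans (lookup-embv ts q) (trans (cong emb (agree q q<i)) (sym (lookup-embv us q)))) ,
  subst₂ _⊳_ (sym (lookup-embv ts i)) (sym (lookup-embv us i)) (emb-⊳ ts⊳us)

module RankLex {S : Sig} (rank : Sym S → ℕ) where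

  data RankLexBelow (f : Sym S) (ts : Vec (Term S) (ar S f)) : Term S → Set where
    var   : ∀ x → RankLexBelow f ts (var x)
    lower : ∀ {g us} → rank g < rank f → (∀ i → RankLexBelow f ts (lookup us i)) →
            RankLexBelow f ts (fun g us)
    same  : ∀ {us} → Lex _⊳_ 0 ts us → (∀ i → RankLexBelow f ts (lookup us i)) →
            RankLexBelow f ts (fun f us)

  RankLexBelow-⊵ : ∀ {f ts t u} → RankLexBelow f ts t → t ⊵ u → RankLexBelow f ts u
  RankLexBelow-⊵ below          ⊵-refl        = below
  RankLexBelow-⊵ (lower _ args) (⊵-arg i t⊵u) = RankLexBelow-⊵ (args i) t⊵u
  RankLexBelow-⊵ (same _ args)  (⊵-arg i t⊵u) = RankLexBelow-⊵ (args i) t⊵u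

  RankLexRule : Rule S → Set
  RankLexRule (l , r) = ∃₂ λ f ts → l ≡ fun f ts × RankLexBelow f ts r

  RankDecreasingPair : Pair S → Set
  RankDecreasingPair (s , t) = ∃₂ λ f g → ∃₂ λ ts us →
    s ≡ fun (inj₂ f) ts × t ≡ fun (inj₂ g) us × rank g < rank f

  LexPair : ℕ → Pair S → Set
  LexPair j (s , t) = ∃ λ f → ∃₂ λ ts us →
    s ≡ fun (inj₂ f) ts × t ≡ fun (inj₂ f) us × Lex _⊳_ j ts us

  module _ (R : List (Rule S)) (trs : IsTRS R) (rankLex : ∀ {ρ} → ρ ∈ R → RankLexRule ρ)
           (maxAr : ℕ) (ar≤maxAr : ∀ f → ar S f ≤ maxAr) where

    DP-rankLex : ∀ p → DP R p → RankDecreasingPair p ⊎ LexPair 0 p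
    DP-rankLex (s , t) (l , r , u , l→r , r⊵u , _ , (g , us , refl , _) , refl , refl)
      with rankLex l→r
    ... | f , ts , refl , below with RankLexBelow-⊵ below r⊵u
    ... | lower g<f _  = inj₁ (f , g , embv ts , embv us , refl , refl , g<f)
    ... | same ts>us _ = inj₂ (f , embv ts , embv us , refl , refl , Lex-embv {ts = ts} {us} ts>us)

    LexDPs : ℕ → PSet S
    LexDPs j p = DP R p × LexPair j p

    -- The subterm criterion projecting on argument j removes the pairs first decreasing at j.
    subterm-step : ∀ j → ProofTree R (LexDPs (suc j)) → ProofTree R (LexDPs j)
    subterm-step j = sc (LexDPs (suc j)) (λ _ → j) weaken kept removed
      where
      weaken : LexDPs (suc j) ⊆P LexDPs j
      weaken p (dp , f , ts , us , s≡ , t≡ , i , j<i , agree , ts⊳us) =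
        dp , f , ts , us , s≡ , t≡ , i , <⇒≤ j<i , agree , ts⊳us

      kept : ∀ s t → LexDPs (suc j) (s , t) → ∃₂ λ a b → Proj (λ _ → j) s a × Proj (λ _ → j) t b × a ⊵ b
      kept s t (_ , f , ts , us , refl , refl , i , j<i , agree , _) =
        let j<ar = <-trans j<i (toℕ<n i)
            q<i  = subst (_< toℕ i) (sym (toℕ-fromℕ< j<ar)) j<i
        in _ , _ , proj ts j<ar , proj us j<ar , subst (_ ⊵_) (agree _ q<i) ⊵-refl

      removed : ∀ s t → LexDPs j (s , t) → ¬ LexDPs (suc j) (s , t) →
                ∃₂ λ a b → Proj (λ _ → j) s a × Proj (λ _ → j) t b × a ⊳ b
      removed s t (dp , f , ts , us , refl , refl , i , j≤i , agree , ts⊳us) ¬lex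
        with m≤n⇒m<n∨m≡n j≤i
      ... | inj₁ j<i  = ⊥-elim (¬lex (dp , f , ts , us , refl , refl , i , j<i , agree , ts⊳us))
      ... | inj₂ refl = _ , _ , proj ts (toℕ<n i) , proj us (toℕ<n i) ,
                        subst (λ q → lookup ts q ⊳ lookup us q) (sym (fromℕ<-toℕ i (toℕ<n i))) ts⊳us

    LexDPs-tree : ∀ d j → maxAr ≤ d + j → ProofTree R (LexDPs j)
    LexDPs-tree zero    j maxAr≤j = leaf λ where
      (s , t) (_ , f , _ , _ , _ , _ , i , j≤i , _) →
        n≮n maxAr (≤-<-trans (≤-trans maxAr≤j j≤i) (<-≤-trans (toℕ<n i) (ar≤maxAr f)))
    LexDPs-tree (suc d) j maxAr≤ =
      subterm-step j (LexDPs-tree d (suc j) (≤-trans maxAr≤ (≤-reflexive (sym (+-suc d j)))))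

    -- The rank pair removes the pairs going down in rank; the remaining ones descend lexicographically.
    rankLexProofTree : ProofTree R (DP R)
    rankLexProofTree = rp (LexDPs 0) rankPair (λ _ → proj₁) weak rules-weak strict
                         (LexDPs-tree maxAr 0 (≤-reflexive (sym (+-identityʳ maxAr))))
      where
      open RankPair S rank
      weak : ∀ s t → LexDPs 0 (s , t) → s ≽ t
      weak s t (_ , _ , _ , _ , refl , refl , _) α = ≤-refl
      rules-weak : ∀ l r → (l , r) ∈ R → emb l ≽ emb r
      rules-weak l r l→r = emb-≽ l r (proj₂ (trs l→r))
      strict : ∀ s t → DP R (s , t) → ¬ LexDPs 0 (s , t) → s ≻ t
      strict s t dp ¬lex with DP-rankLex (s , t) dp
      ... | inj₁ (_ , _ , _ , _ , refl , refl , g<f) = λ α → g<f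
      ... | inj₂ lex = ⊥-elim (¬lex (dp , lex))

-- Symbols 0 and s for numerals and F₀, …, Fₘ of arity K; the rank of a symbol is its index,
-- so Fⱼ has rank j + 2 (symF saturates at m).
module Signature (B m : ℕ) where

  K : ℕ
  K = suc (suc B)

  N : ℕ
  N = suc (suc (suc m))

  arity : Fin N → ℕ
  arity zero          = 0
  arity (suc zero)    = 1
  arity (suc (suc _)) = K

  Sg : Sig
  Sg = FinSig N arity

  Tm : Set
  Tm = Term Sg

  open RankLex {Sg} toℕ public

  clamp : ∀ {n} → ℕ → Fin (suc n)
  clamp {zero}  _       = zero
  clamp {suc n} zero    = zero
  clamp {suc n} (suc j) = suc (clamp j)

  toℕ-clamp : ∀ {n} j → j ≤ n → toℕ (clamp {n} j) ≡ j
  toℕ-clamp {zero}  zero    _         = refl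
  toℕ-clamp {suc n} zero    _         = refl
  toℕ-clamp {suc n} (suc j) (s≤s j≤n) = cong suc (toℕ-clamp j j≤n)

  symF : ℕ → Fin N
  symF j = suc (suc (clamp j))

  toℕ-symF : ∀ j → j ≤ m → toℕ (symF j) ≡ suc (suc j)
  toℕ-symF j j≤m = cong (λ i → suc (suc i)) (toℕ-clamp j j≤m)

  zeroᵀ : Tm
  zeroᵀ = fun zero []

  sucᵀ : Tm → Tm
  sucᵀ t = fun (suc zero) (t ∷ [])

  ⌜_⌝ : ℕ → Tm
  ⌜ zero ⌝  = zeroᵀ
  ⌜ suc n ⌝ = sucᵀ ⌜ n ⌝

  -- The argument list is padded with 0 (or truncated) to length K.
  args : List Tm → Vec Tm K
  args P = tabulate (λ i → nth zeroᵀ P (toℕ i))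

  F : ℕ → List Tm → Tm
  F j P = fun (symF j) (args P)

  lookup-args : ∀ P i → lookup (args P) i ≡ nth zeroᵀ P (toℕ i)
  lookup-args P = lookup∘tabulate (λ i → nth zeroᵀ P (toℕ i))

  vars : ℕ → List Tm
  vars = applyUpTo var

  vars₁ : ℕ → List Tm
  vars₁ = applyUpTo (λ x → var (suc x))

  length-vars : ∀ n → length (vars n) ≡ n
  length-vars = length-applyUpTo var

  vars≤K : ∀ {n} → n ≤ K → length (vars n) ≤ K
  vars≤K {n} = subst (_≤ K) (sym (length-vars n))

  var-∈-vars : ∀ {x n} → x < n → var x ∈ vars n
  var-∈-vars = ∈-applyUpTo⁺ var

  var-∈-vars₁ : ∀ {x n} → x < n → var (suc x) ∈ vars₁ n
  var-∈-vars₁ = ∈-applyUpTo⁺ (λ x → var (suc x))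

  σ[_] : List ℕ → Subst Sg
  σ[ xs ] x = ⌜ nth 0 xs x ⌝

  Inst : Subst Sg → List Tm → List Tm → Set
  Inst σ = Pointwise (λ t u → t · σ ≡ u)

  NumInst : Subst Sg → List Tm → List ℕ → Set
  NumInst σ = Pointwise (λ t n → t · σ ≡ ⌜ n ⌝)

  NumInst⇒Inst : ∀ {σ P xs} → NumInst σ P xs → Inst σ P (map ⌜_⌝ xs)
  NumInst⇒Inst []         = []
  NumInst⇒Inst (eq ∷ eqs) = eq ∷ NumInst⇒Inst eqs

  F-inst : ∀ j {σ P Q} → Inst σ P Q → F j P · σ ≡ F j Q
  F-inst j {σ} {P} {Q} P→Q = cong (fun (symF j)) (begin
    args P ·v σ
      ≡⟨ ·v-tabulate (λ i → nth zeroᵀ P (toℕ i)) ⟩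
    tabulate (λ i → nth zeroᵀ P (toℕ i) · σ)
      ≡⟨ tabulate-cong (λ i → nth-map zeroᵀ (_· σ) refl P (toℕ i)) ⟩
    tabulate (λ i → nth zeroᵀ (map (_· σ) P) (toℕ i))
      ≡⟨ cong args (Pointwise.Pointwise-≡⇒≡ (map-inst P→Q)) ⟩
    args Q
      ∎)
    where
    open ≡-Reasoning
    ·v-tabulate : ∀ {n} (f : Fin n → Tm) → tabulate f ·v σ ≡ tabulate (λ i → f i · σ)
    ·v-tabulate {zero}  f = refl
    ·v-tabulate {suc n} f = cong (f zero · σ ∷_) (·v-tabulate (f ∘ suc))
    map-inst : ∀ {P Q} → Inst σ P Q → Pointwise _≡_ (map (_· σ) P) Q
    map-inst []         = []
    map-inst (eq ∷ eqs) = eq ∷ map-inst eqs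

  F-numInst : ∀ j {σ P xs} → NumInst σ P xs → F j P · σ ≡ F j (map ⌜_⌝ xs)
  F-numInst j = F-inst j ∘ NumInst⇒Inst

  NumInst-applyUpTo : ∀ {σ} f g n → (∀ i → i < n → f i · σ ≡ ⌜ g i ⌝) →
                      NumInst σ (applyUpTo f n) (applyUpTo g n)
  NumInst-applyUpTo f g zero    _  = []
  NumInst-applyUpTo f g (suc n) eq =
    eq 0 (s≤s z≤n) ∷ NumInst-applyUpTo (f ∘ suc) (g ∘ suc) n (λ i → eq (suc i) ∘ s≤s)

  vars-inst : ∀ {σ n} xs → length xs ≡ n → (∀ i → i < n → σ i ≡ ⌜ nth 0 xs i ⌝) → NumInst σ (vars n) xs
  vars-inst {σ} xs refl eq = subst (NumInst σ (vars (length xs))) (applyUpTo-nth 0 xs)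
                               (NumInst-applyUpTo var (nth 0 xs) (length xs) eq)

  vars-inst-++ : ∀ ys zs {n} → length ys ≡ n → NumInst σ[ ys ++ zs ] (vars n) ys
  vars-inst-++ ys zs refl = vars-inst ys refl (λ i i< → cong ⌜_⌝ (nth-++ˡ 0 ys zs i i<))

  vars₁-inst : ∀ {n} a xs → length xs ≡ n → NumInst σ[ a ∷ xs ] (vars₁ n) xs
  vars₁-inst a xs refl = subst (NumInst σ[ a ∷ xs ] (vars₁ (length xs))) (applyUpTo-nth 0 xs)
                           (NumInst-applyUpTo (λ x → var (suc x)) (nth 0 xs) (length xs) (λ _ _ → refl))

  zeros-inst : ∀ {σ} n → NumInst σ (replicate n zeroᵀ) (replicate n 0)
  zeros-inst n = Pointwise.replicate⁺ refl n

  module _ (R : List (Rule Sg)) where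
    open Rewriting R

    F-⟶* : ∀ j {X Y} → Pointwise _⟶*_ X Y → F j X ⟶* F j Y
    F-⟶* j {X} {Y} X⟶Y = ⟶*-fun (symF j) (args X) (args Y) λ i →
      subst₂ _⟶*_ (sym (lookup-args X i)) (sym (lookup-args Y i)) (nth-Pointwise ε X⟶Y (toℕ i))

  symF-< : ∀ {i j} → i < j → j ≤ m → toℕ (symF i) < toℕ (symF j)
  symF-< {i} {j} i<j j≤m =
    subst₂ _<_ (sym (toℕ-symF i (≤-trans (<⇒≤ i<j) j≤m))) (sym (toℕ-symF j j≤m)) (s≤s (s≤s i<j))

  module _ {f : Fin N} {ts : Vec Tm (arity f)} where

    below-args : ∀ {Q} → RankLexBelow f ts zeroᵀ → All (RankLexBelow f ts) Q →
                 ∀ i → RankLexBelow f ts (lookup (args Q) i)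
    below-args {Q} z↓ Q↓ i = subst (RankLexBelow f ts) (sym (lookup-args Q i)) (nth-All z↓ Q↓ (toℕ i))

    below-zero : 0 < toℕ f → RankLexBelow f ts zeroᵀ
    below-zero 0<f = lower 0<f (λ ())

    below-suc : ∀ {t} → 1 < toℕ f → RankLexBelow f ts t → RankLexBelow f ts (sucᵀ t)
    below-suc 1<f t↓ = lower 1<f λ { zero → t↓ }

    below-F : ∀ j {Q} → toℕ (symF j) < toℕ f → All (RankLexBelow f ts) Q → RankLexBelow f ts (F j Q)
    below-F j j<f Q↓ = lower j<f (below-args (below-zero (<-trans z<s j<f)) Q↓)

  vars↓ : ∀ {f ts} n → All (RankLexBelow f ts) (vars n)
  vars↓ n = applyUpTo⁺₂ var n var

  vars₁↓ : ∀ {f ts} n → All (RankLexBelow f ts) (vars₁ n)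
  vars₁↓ n = applyUpTo⁺₂ (λ x → var (suc x)) n (λ x → var (suc x))

  sucᵀ-⊳ : ∀ t → sucᵀ t ⊳ t
  sucᵀ-⊳ t = ⊳-arg zero ⊵-refl

  Lex-args : ∀ {P Q} → length P ≤ K → LexList _⊳_ P Q → Lex _⊳_ 0 (args P) (args Q)
  Lex-args {P} {Q} P≤K P>Q with LexList⇒nth zeroᵀ P>Q
  ... | j , j<P , agree , at = fromℕ< j<K , z≤n , agree′ ,
        subst₂ _⊳_ (sym (lookup-fromℕ< P)) (sym (lookup-fromℕ< Q)) at
    where
    j<K = <-≤-trans j<P P≤K
    lookup-fromℕ< : ∀ L → lookup (args L) (fromℕ< j<K) ≡ nth zeroᵀ L j
    lookup-fromℕ< L = trans (lookup-args L _) (cong (nth zeroᵀ L) (toℕ-fromℕ< j<K))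
    agree′ : ∀ q → q Fin.< fromℕ< j<K → lookup (args P) q ≡ lookup (args Q) q
    agree′ q q<j = begin
      lookup (args P) q    ≡⟨ lookup-args P q ⟩
      nth zeroᵀ P (toℕ q)  ≡⟨ agree (toℕ q) (subst (toℕ q <_) (toℕ-fromℕ< j<K) q<j) ⟩
      nth zeroᵀ Q (toℕ q)  ≡˘⟨ lookup-args Q q ⟩
      lookup (args Q) q    ∎
      where open ≡-Reasoning

  VarsIn : (ℕ → Set) → Tm → Set
  VarsIn Q t = ∀ x → x ∈V t → Q x

  module _ {Q : ℕ → Set} where

    var-vars : ∀ {x} → Q x → VarsIn Q (var x)
    var-vars qx _ here = qx

    zero-vars : VarsIn Q zeroᵀ
    zero-vars x (arg () _)

    suc-vars : ∀ {t} → VarsIn Q t → VarsIn Q (sucᵀ t)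
    suc-vars t-vars x (arg zero x∈) = t-vars x x∈

    F-vars : ∀ j {P} → All (VarsIn Q) P → VarsIn Q (F j P)
    F-vars j {P} P-vars x (arg i x∈) =
      nth-All zero-vars P-vars (toℕ i) x (subst (x ∈V_) (lookup-args P i) x∈)

    vars-vars : ∀ n → (∀ {x} → x < n → Q x) → All (VarsIn Q) (vars n)
    vars-vars n Q< = applyUpTo⁺₁ var n (var-vars ∘ Q<)

    vars₁-vars : ∀ n → (∀ {x} → x < n → Q (suc x)) → All (VarsIn Q) (vars₁ n)
    vars₁-vars n Q< = applyUpTo⁺₁ (λ x → var (suc x)) n (var-vars ∘ Q<)

    zeros-vars : ∀ n → All (VarsIn Q) (replicate n zeroᵀ)
    zeros-vars n = replicate⁺ n zero-vars

  VarCondition : Rule Sg → Set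
  VarCondition (l , r) = VarsIn (_∈V l) r

  GoodRule : Rule Sg → Set
  GoodRule ρ = RankLexRule ρ × VarCondition ρ

  -- P is a parameter because it cannot be inferred from F j P: args is not injective.
  module Lhs (j : ℕ) (P : List Tm) (P≤K : length P ≤ K) where

    below-same : ∀ {Q} → LexList _⊳_ P Q → All (RankLexBelow (symF j) (args P)) Q →
                 RankLexBelow (symF j) (args P) (F j Q)
    below-same P>Q Q↓ = same (Lex-args P≤K P>Q) (below-args (below-zero z<s) Q↓)

    ∈V-lhs : ∀ {t x} → t ∈ P → x ∈V t → x ∈V F j P
    ∈V-lhs {t} {x} t∈P x∈t with ∈⇒nth zeroᵀ t∈P
    ... | i , i<P , nth≡t = arg (fromℕ< i<K) (subst (x ∈V_) (sym lookup≡t) x∈t)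
      where
      i<K = <-≤-trans i<P P≤K
      lookup≡t = trans (lookup-args P _) (trans (cong (nth zeroᵀ P) (toℕ-fromℕ< i<K)) nth≡t)

    var-lhs : ∀ {x} → var x ∈ P → x ∈V F j P
    var-lhs x∈P = ∈V-lhs x∈P here

    sucᵀ-var-lhs : ∀ {x} → sucᵀ (var x) ∈ P → x ∈V F j P
    sucᵀ-var-lhs sx∈P = ∈V-lhs sx∈P (arg zero here)

    good : ∀ {r} → RankLexBelow (symF j) (args P) r → VarsIn (_∈V F j P) r → GoodRule (F j P , r)
    good r↓ r-vars = (symF j , args P , refl , r↓) , r-vars

-- The Ackermann function

module Ackermann (B m : ℕ) where
  open Signature B m

  A : List Tm → Tm
  A = F 0

  -- The equations of AckGraph for arity K, read from left to right.
  ack-base-rule ack-zero-rule ack-step-rule : Rule Sg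
  ack-base-rule = A (replicate (suc B) zeroᵀ ++ var 0 ∷ []) , sucᵀ (var 0)
  ack-zero-rule = A (vars B ++ sucᵀ (var B) ∷ zeroᵀ ∷ []) , A (vars B ++ var B ∷ sucᵀ zeroᵀ ∷ [])
  ack-step-rule = A (vars B ++ sucᵀ (var B) ∷ sucᵀ (var (suc B)) ∷ []) ,
                  A (vars B ++ var B ∷ A (vars B ++ sucᵀ (var B) ∷ var (suc B) ∷ []) ∷ [])

  ack-diag-rule : ℕ → ℕ → Rule Sg
  ack-diag-rule p z = A (vars p ++ sucᵀ (var p) ∷ replicate (suc z) zeroᵀ ++ var (suc p) ∷ []) ,
                      A (vars p ++ var p ∷ var (suc p) ∷ replicate z zeroᵀ ++ var (suc p) ∷ [])

  ackRules : List (Rule Sg)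
  ackRules =
    ack-base-rule ∷ ack-zero-rule ∷ ack-step-rule ∷ applyUpTo (λ p → ack-diag-rule p (B ∸ suc p)) B

  ack-diag-∈ : ∀ p z → p + suc z ≡ B → ack-diag-rule p z ∈ ackRules
  ack-diag-∈ p z refl =
    there (there (there (subst (λ z′ → ack-diag-rule p z′ ∈ applyUpTo diag (p + suc z)) z′≡z
      (∈-applyUpTo⁺ diag (m<m+n p z<s)))))
    where
    diag = λ q → ack-diag-rule q (p + suc z ∸ suc q)
    z′≡z : p + suc z ∸ suc p ≡ z
    z′≡z = trans (cong (_∸ suc p) (+-suc p z)) (m+n∸m≡n p z)

  -- Every left-hand side of AckGraph has this shape.
  length-ackArgs : ∀ {A : Set} (ys : List A) a n b c →
                   length (ys ++ a ∷ replicate n b ++ c ∷ []) ≡ suc (suc (length ys + n))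
  length-ackArgs ys a n b c = begin
    length (ys ++ a ∷ replicate n b ++ c ∷ [])
      ≡⟨ length-++ ys ⟩
    length ys + suc (length (replicate n b ++ c ∷ []))
      ≡⟨ cong (λ l → length ys + suc l) (length-++ (replicate n b)) ⟩
    length ys + suc (length (replicate n b) + 1)
      ≡⟨ cong (λ l → length ys + suc l) (trans (cong (_+ 1) (length-replicate n)) (+-comm n 1)) ⟩
    length ys + suc (suc n)
      ≡⟨ +-suc (length ys) (suc n) ⟩
    suc (length ys + suc n)
      ≡⟨ cong suc (+-suc (length ys) n) ⟩
    suc (suc (length ys + n))
      ∎
    where open ≡-Reasoning

  length-ackArgs-K : ∀ (ys : List ℕ) a n b c → length (ys ++ a ∷ replicate n b ++ c ∷ []) ≡ K →
                     length ys + n ≡ B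
  length-ackArgs-K ys a n b c eq = suc-injective (suc-injective (trans (sym (length-ackArgs ys a n b c)) eq))

  length-ackArgs-K₀ : ∀ (ys : List ℕ) a b → length (ys ++ a ∷ b ∷ []) ≡ K → length ys ≡ B
  length-ackArgs-K₀ ys a b eq = trans (sym (+-identityʳ _)) (length-ackArgs-K ys a 0 b b eq)

  length-swap : ∀ (ys : List ℕ) {a b a′ b′ r} →
                length (ys ++ a ∷ b ∷ r) ≡ length (ys ++ a′ ∷ b′ ∷ r)
  length-swap []       = refl
  length-swap (y ∷ ys) = cong suc (length-swap ys)

  var-at₁ : ∀ ys {a r n} → length ys ≡ n → var n · σ[ ys ++ a ∷ r ] ≡ ⌜ a ⌝
  var-at₁ ys {a} {r} refl = cong ⌜_⌝ (nth-length 0 ys a r)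

  var-at₂ : ∀ ys {a b r n} → length ys ≡ n → var (suc n) · σ[ ys ++ a ∷ b ∷ r ] ≡ ⌜ b ⌝
  var-at₂ []       refl = refl
  var-at₂ (y ∷ ys) refl = var-at₂ ys refl

  -- A_(k+1)(0, x̄) = A_k(x̄), so F₀ also computes the Ackermann functions of smaller arity.
  ack-pad₁ : ∀ {L v} → AckGraph L v → AckGraph (0 ∷ L) v
  ack-pad₁ (ack-base n x)              = ack-base (suc n) x
  ack-pad₁ (ack-zero ys a v D)         = ack-zero (0 ∷ ys) a v (ack-pad₁ D)
  ack-pad₁ (ack-step ys a y w v D₁ D₂) = ack-step (0 ∷ ys) a y w v (ack-pad₁ D₁) (ack-pad₁ D₂)
  ack-pad₁ (ack-diag ys a z x v D)     = ack-diag (0 ∷ ys) a z x v (ack-pad₁ D)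

  ack-pad : ∀ n {L v} → AckGraph L v → AckGraph (replicate n 0 ++ L) v
  ack-pad zero    D = D
  ack-pad (suc n) D = ack-pad₁ (ack-pad n D)

  module Evaluation (R : List (Rule Sg)) (ack⊆R : ackRules ⊆ R) where
    open Rewriting R

    AckGraph⇒⟶* : ∀ {L v} → AckGraph L v → length L ≡ K → A (map ⌜_⌝ L) ⟶* ⌜ v ⌝
    AckGraph⇒⟶* (ack-base n x) len with length-ackArgs-K [] 0 n 0 x len
    ... | refl = root-step* (ack⊆R (here refl)) σ[ x ∷ [] ]
                   (F-numInst 0 (Pointwise.++⁺ (zeros-inst (suc n)) (refl ∷ []))) refl
    AckGraph⇒⟶* (ack-zero ys a v D) len =
      root-step* (ack⊆R (there (here refl))) σ[ ys ++ a ∷ [] ]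
        (F-numInst 0 (Pointwise.++⁺ (vars-inst-++ ys _ |ys|) (cong sucᵀ (var-at₁ ys |ys|) ∷ refl ∷ [])))
        (F-numInst 0 (Pointwise.++⁺ (vars-inst-++ ys _ |ys|) (var-at₁ ys |ys| ∷ refl ∷ [])))
      ◅◅ AckGraph⇒⟶* D (trans (length-swap ys) len)
      where |ys| = length-ackArgs-K₀ ys (suc a) 0 len
    AckGraph⇒⟶* (ack-step ys a y w v D₁ D₂) len =
      root-step* (ack⊆R (there (there (here refl)))) σ[ ys ++ a ∷ y ∷ [] ]
        (F-numInst 0 (Pointwise.++⁺ ys-inst (cong sucᵀ a-inst ∷ cong sucᵀ y-inst ∷ [])))
        (F-inst 0 (Pointwise.++⁺ (NumInst⇒Inst ys-inst) (a-inst ∷ inner-inst ∷ [])))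
      ◅◅ subst (λ L → A (map ⌜_⌝ ys ++ ⌜ a ⌝ ∷ inner ∷ []) ⟶* A L) (sym (map-++ ⌜_⌝ ys (a ∷ w ∷ [])))
           (F-⟶* R 0 (Pointwise.++⁺ (Pointwise.refl ε {map ⌜_⌝ ys}) (ε ∷ AckGraph⇒⟶* D₁ (trans (length-swap ys) len) ∷ [])))
      ◅◅ AckGraph⇒⟶* D₂ (trans (length-swap ys) len)
      where
      |ys|    = length-ackArgs-K₀ ys (suc a) (suc y) len
      ys-inst = vars-inst-++ ys (a ∷ y ∷ []) |ys|
      a-inst  = var-at₁ ys |ys|
      y-inst  = var-at₂ ys |ys|
      inner   = A (map ⌜_⌝ (ys ++ suc a ∷ y ∷ []))
      inner-inst : A (vars B ++ sucᵀ (var B) ∷ var (suc B) ∷ []) · σ[ ys ++ a ∷ y ∷ [] ] ≡ inner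
      inner-inst = F-numInst 0 (Pointwise.++⁺ ys-inst (cong sucᵀ a-inst ∷ y-inst ∷ []))
    AckGraph⇒⟶* (ack-diag ys a z x v D) len =
      root-step* (ack⊆R diag∈) σ[ ys ++ a ∷ x ∷ [] ]
        (F-numInst 0 (Pointwise.++⁺ (vars-inst-++ ys _ refl)
          (cong sucᵀ (var-at₁ ys refl) ∷ Pointwise.++⁺ (zeros-inst (suc z)) (var-at₂ ys refl ∷ []))))
        (F-numInst 0 (Pointwise.++⁺ (vars-inst-++ ys _ refl)
          (var-at₁ ys refl ∷ var-at₂ ys refl ∷ Pointwise.++⁺ (zeros-inst z) (var-at₂ ys refl ∷ []))))
      ◅◅ AckGraph⇒⟶* D (trans (length-swap ys) len)
      where diag∈ = ack-diag-∈ (length ys) z (length-ackArgs-K ys (suc a) (suc z) 0 x len)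

  ackArgs≤K : ∀ p a n b c → p + n ≡ B → length (vars p ++ a ∷ replicate n b ++ c ∷ []) ≤ K
  ackArgs≤K p a n b c eq = ≤-reflexive (trans (length-ackArgs (vars p) a n b c)
                                   (cong (λ l → suc (suc l)) (trans (cong (_+ n) (length-vars p)) eq)))

  ackRules-good : All GoodRule ackRules
  ackRules-good = base ∷ zero-rule ∷ step ∷ applyUpTo⁺₁ _ B diag
    where
    base : GoodRule ack-base-rule
    base = good (below-suc (s≤s (s≤s z≤n)) (var 0))
                (suc-vars (var-vars (var-lhs (∈-++⁺ʳ (replicate (suc B) zeroᵀ) (here refl)))))
      where open Lhs 0 (replicate (suc B) zeroᵀ ++ var 0 ∷ []) (ackArgs≤K 0 zeroᵀ B zeroᵀ (var 0) refl)

    zero-rule : GoodRule ack-zero-rule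
    zero-rule =
      good (below-same (LexList-++ (vars B) (lex-head (sucᵀ-⊳ (var B))))
             (++⁺ (vars↓ B) (var B ∷ below-suc (s≤s (s≤s z≤n)) (below-zero z<s) ∷ [])))
           (F-vars 0 (++⁺ (vars-vars B (λ x<B → var-lhs (∈-++⁺ˡ (var-∈-vars x<B))))
             (var-vars (sucᵀ-var-lhs (∈-++⁺ʳ (vars B) (here refl))) ∷ suc-vars zero-vars ∷ [])))
      where open Lhs 0 (vars B ++ sucᵀ (var B) ∷ zeroᵀ ∷ []) (ackArgs≤K B _ 0 zeroᵀ zeroᵀ (+-identityʳ B))

    step : GoodRule ack-step-rule
    step =
      good (below-same (LexList-++ (vars B) (lex-head (sucᵀ-⊳ (var B))))
             (++⁺ (vars↓ B) (var B ∷ below-same (LexList-++ (vars B) (lex-tail (lex-head (sucᵀ-⊳ (var (suc B))))))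
               (++⁺ (vars↓ B) (below-suc (s≤s (s≤s z≤n)) (var B) ∷ var (suc B) ∷ [])) ∷ [])))
           (F-vars 0 (++⁺ prefix (B-vars ∷ F-vars 0 (++⁺ prefix (suc-vars B-vars ∷ sB-vars ∷ [])) ∷ [])))
      where
      open Lhs 0 (vars B ++ sucᵀ (var B) ∷ sucᵀ (var (suc B)) ∷ [])
                 (ackArgs≤K B _ 0 zeroᵀ (sucᵀ (var (suc B))) (+-identityʳ B))
      prefix = vars-vars B (λ x<B → var-lhs (∈-++⁺ˡ (var-∈-vars x<B)))
      B-vars = var-vars (sucᵀ-var-lhs (∈-++⁺ʳ (vars B) (here refl)))
      sB-vars = var-vars (sucᵀ-var-lhs (∈-++⁺ʳ (vars B) (there (here refl))))

    diag : ∀ {p} → p < B → GoodRule (ack-diag-rule p (B ∸ suc p))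
    diag {p} p<B =
      good (below-same (LexList-++ (vars p) (lex-head (sucᵀ-⊳ (var p))))
             (++⁺ (vars↓ p) (var p ∷ var (suc p) ∷ ++⁺ (replicate⁺ z (below-zero z<s)) (var (suc p) ∷ []))))
           (F-vars 0 (++⁺ (vars-vars p (λ x<p → var-lhs (∈-++⁺ˡ (var-∈-vars x<p))))
             (p-vars ∷ x-vars ∷ ++⁺ (zeros-vars z) (x-vars ∷ []))))
      where
      z = B ∸ suc p
      open Lhs 0 (vars p ++ sucᵀ (var p) ∷ replicate (suc z) zeroᵀ ++ var (suc p) ∷ [])
                 (ackArgs≤K p _ (suc z) zeroᵀ (var (suc p)) (trans (+-suc p z) (m+[n∸m]≡n p<B)))
      p-vars = var-vars (sucᵀ-var-lhs (∈-++⁺ʳ (vars p) (here refl)))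
      x-vars = var-vars (var-lhs (∈-++⁺ʳ (vars p) (there (∈-++⁺ʳ (replicate (suc z) zeroᵀ) (here refl)))))

-- Compiling codes

mutual
  maxArity : ∀ {k} → MR k → ℕ
  maxArity {k} (zeroF _)    = k
  maxArity     succF        = 1
  maxArity {k} (projF _)    = k
  maxArity     (ackF k _)   = k
  maxArity {k} (compF h gs) = k ⊔ (maxArity h ⊔ maxArity* gs)
  maxArity     (precF g h)  = maxArity g ⊔ maxArity h

  maxArity* : ∀ {k m} → Vec (MR k) m → ℕ
  maxArity* []       = 0
  maxArity* (g ∷ gs) = maxArity g ⊔ maxArity* gs

mutual
  AritiesAtMost : ℕ → ∀ {k} → MR k → Set
  AritiesAtMost n {k} (zeroF _)    = k ≤ n
  AritiesAtMost n     succF        = 1 ≤ n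
  AritiesAtMost n {k} (projF _)    = k ≤ n
  AritiesAtMost n     (ackF k _)   = k ≤ n
  AritiesAtMost n {k} (compF h gs) = k ≤ n × AritiesAtMost n h × AritiesAtMost* n gs
  AritiesAtMost n     (precF g h)  = AritiesAtMost n g × AritiesAtMost n h

  AritiesAtMost* : ℕ → ∀ {k m} → Vec (MR k) m → Set
  AritiesAtMost* n []       = ⊤
  AritiesAtMost* n (g ∷ gs) = AritiesAtMost n g × AritiesAtMost* n gs

mutual
  maxArity⇒AritiesAtMost : ∀ {n k} (g : MR k) → maxArity g ≤ n → AritiesAtMost n g
  maxArity⇒AritiesAtMost (zeroF _)    ≤n = ≤n
  maxArity⇒AritiesAtMost succF        ≤n = ≤n
  maxArity⇒AritiesAtMost (projF _)    ≤n = ≤n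
  maxArity⇒AritiesAtMost (ackF _ _)   ≤n = ≤n
  maxArity⇒AritiesAtMost {k = k} (compF h gs) ≤n =
    m⊔n≤o⇒m≤o k _ ≤n ,
    maxArity⇒AritiesAtMost h (m⊔n≤o⇒m≤o (maxArity h) _ (m⊔n≤o⇒n≤o k _ ≤n)) ,
    maxArity*⇒AritiesAtMost* gs (m⊔n≤o⇒n≤o (maxArity h) _ (m⊔n≤o⇒n≤o k _ ≤n))
  maxArity⇒AritiesAtMost (precF g h)  ≤n =
    maxArity⇒AritiesAtMost g (m⊔n≤o⇒m≤o (maxArity g) _ ≤n) ,
    maxArity⇒AritiesAtMost h (m⊔n≤o⇒n≤o (maxArity g) _ ≤n)

  maxArity*⇒AritiesAtMost* : ∀ {n k m} (gs : Vec (MR k) m) → maxArity* gs ≤ n → AritiesAtMost* n gs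
  maxArity*⇒AritiesAtMost* []       ≤n = tt
  maxArity*⇒AritiesAtMost* (g ∷ gs) ≤n =
    maxArity⇒AritiesAtMost g (m⊔n≤o⇒m≤o (maxArity g) _ ≤n) ,
    maxArity*⇒AritiesAtMost* gs (m⊔n≤o⇒n≤o (maxArity g) _ ≤n)

arity≤ : ∀ {n k} (g : MR k) → AritiesAtMost n g → k ≤ n
arity≤ (zeroF _)   ≤n        = ≤n
arity≤ succF       ≤n        = ≤n
arity≤ (projF _)   ≤n        = ≤n
arity≤ (ackF _ _)  ≤n        = ≤n
arity≤ (compF _ _) (≤n , _)  = ≤n
arity≤ (precF g h) (_ , h≤n) = ≤-trans (n≤1+n _) (arity≤ h h≤n)

-- A code g compiled at offset o uses the symbols F_o, …, F_(main o g), its own one being the last.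
mutual
  #syms : ∀ {k} → MR k → ℕ
  #syms g = suc (#subsyms g)

  #subsyms : ∀ {k} → MR k → ℕ
  #subsyms (compF h gs) = #syms h + #syms* gs
  #subsyms (precF g h)  = #syms g + #syms h
  #subsyms _            = 0

  #syms* : ∀ {k m} → Vec (MR k) m → ℕ
  #syms* []       = 0
  #syms* (g ∷ gs) = #syms g + #syms* gs

main : ∀ {k} → ℕ → MR k → ℕ
main o g = o + #subsyms g

mains : ∀ {k m} → ℕ → Vec (MR k) m → List ℕ
mains o []       = []
mains o (g ∷ gs) = main o g ∷ mains (o + #syms g) gs

module Compile (B m : ℕ) where
  open Signature B m
  open Ackermann B m hiding (module Evaluation)

  calls : ℕ → List ℕ → List Tm
  calls k = map (λ j → F j (vars k))

  ownRules : ∀ {k} → ℕ → MR k → List (Rule Sg)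
  ownRules {k} o g@(zeroF _)   = (F (main o g) (vars k) , zeroᵀ) ∷ []
  ownRules     o g@succF       = (F (main o g) (vars 1) , sucᵀ (var 0)) ∷ []
  ownRules {k} o g@(projF i)   = (F (main o g) (vars k) , var (toℕ i)) ∷ []
  ownRules {k} o g@(ackF _ _)  = (F (main o g) (vars k) , A (replicate (K ∸ k) zeroᵀ ++ vars k)) ∷ []
  ownRules {k} o g@(compF h gs) =
    (F (main o g) (vars k) , F (main o h) (calls k (mains (o + #syms h) gs))) ∷ []
  ownRules o g@(precF {k} g₀ h) =
    (F (main o g) (zeroᵀ ∷ vars₁ k) , F (main o g₀) (vars₁ k)) ∷
    (F (main o g) (sucᵀ (var 0) ∷ vars₁ k) ,
     F (main (o + #syms g₀) h) (var 0 ∷ F (main o g) (vars (suc k)) ∷ vars₁ k)) ∷ []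

  mutual
    rules : ∀ {k} → ℕ → MR k → List (Rule Sg)
    rules o g = subcodeRules o g ++ ownRules o g

    subcodeRules : ∀ {k} → ℕ → MR k → List (Rule Sg)
    subcodeRules o (compF h gs) = rules o h ++ rules* (o + #syms h) gs
    subcodeRules o (precF g h)  = rules o g ++ rules (o + #syms g) h
    subcodeRules o _            = []

    rules* : ∀ {k m} → ℕ → Vec (MR k) m → List (Rule Sg)
    rules* o []       = []
    rules* o (g ∷ gs) = rules o g ++ rules* (o + #syms g) gs

  args-inst : ∀ {k} (xs : Vec ℕ k) → NumInst σ[ toList xs ] (vars k) (toList xs)
  args-inst xs = vars-inst (toList xs) (length-toList xs) (λ _ _ → refl)

  calls-inst : ∀ {k} (xs : Vec ℕ k) js →
               Inst σ[ toList xs ] (calls k js) (map (λ j → F j (map ⌜_⌝ (toList xs))) js)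
  calls-inst xs []       = []
  calls-inst xs (j ∷ js) = F-numInst j (args-inst xs) ∷ calls-inst xs js

  length-padded : ∀ {k} (xs : Vec ℕ k) → k ≤ K → length (replicate (K ∸ k) 0 ++ toList xs) ≡ K
  length-padded {k} xs k≤K = begin
    length (replicate (K ∸ k) 0 ++ toList xs)
      ≡⟨ length-++ (replicate (K ∸ k) 0) ⟩
    length (replicate (K ∸ k) 0) + length (toList xs)
      ≡⟨ cong₂ _+_ (length-replicate (K ∸ k)) (length-toList xs) ⟩
    K ∸ k + k
      ≡⟨ m∸n+n≡m k≤K ⟩
    K
      ∎
    where open ≡-Reasoning

  module Evaluation (R : List (Rule Sg)) (ack⊆R : ackRules ⊆ R) where
    open Rewriting R
    open Ackermann.Evaluation B m R ack⊆R

    own⊆ : ∀ {k} o (g : MR k) → rules o g ⊆ R → ownRules o g ⊆ R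
    own⊆ o g g⊆R = g⊆R ∘ ∈-++⁺ʳ (subcodeRules o g)

    mutual
      Eval⇒⟶* : ∀ {k} o (g : MR k) → AritiesAtMost K g → rules o g ⊆ R → ∀ {xs y} → Eval g xs y →
                F (main o g) (map ⌜_⌝ (toList xs)) ⟶* ⌜ y ⌝
      Eval⇒⟶* o (zeroF _) _ g⊆R (ev-zero xs) =
        root-step* (g⊆R (here refl)) σ[ toList xs ] (F-numInst _ (args-inst xs)) refl
      Eval⇒⟶* o succF _ g⊆R (ev-succ x) =
        root-step* (g⊆R (here refl)) σ[ x ∷ [] ] (F-numInst _ (args-inst (x ∷ []))) refl
      Eval⇒⟶* o (projF i) _ g⊆R (ev-proj i xs) =
        root-step* (g⊆R (here refl)) σ[ toList xs ] (F-numInst _ (args-inst xs)) (cong ⌜_⌝ (nth-toList 0 xs i))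
      Eval⇒⟶* {k} o (ackF _ _) k≤K g⊆R (ev-ack _ xs y G) =
        root-step* (g⊆R (here refl)) σ[ toList xs ] (F-numInst _ (args-inst xs))
          (F-numInst 0 (Pointwise.++⁺ (zeros-inst (K ∸ k)) (args-inst xs)))
        ◅◅ AckGraph⇒⟶* (ack-pad (K ∸ k) G) (length-padded xs k≤K)
      Eval⇒⟶* o g@(compF h gs) (_ , h≤K , gs≤K) g⊆R (ev-comp h gs xs ys y Egs Eh) =
        root-step* (own⊆ o g g⊆R (here refl)) σ[ toList xs ]
          (F-numInst _ (args-inst xs)) (F-inst _ (calls-inst xs (mains o′ gs)))
        ◅◅ F-⟶* R (main o h) (EvalAll⇒⟶* o′ gs gs≤K (g⊆R ∘ ∈-++⁺ˡ ∘ ∈-++⁺ʳ (rules o h)) Egs)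
        ◅◅ Eval⇒⟶* o h h≤K (g⊆R ∘ ∈-++⁺ˡ ∘ ∈-++⁺ˡ) Eh
        where o′ = o + #syms h
      Eval⇒⟶* o g@(precF {k} g₀ h) (g₀≤K , _) g⊆R (ev-prec0 g₀ h xs y Eg₀) =
        root-step* (own⊆ o g g⊆R (here refl)) σ[ 0 ∷ toList xs ]
          (F-numInst _ lhs-inst) (F-numInst _ xs-inst)
        ◅◅ Eval⇒⟶* o g₀ g₀≤K (g⊆R ∘ ∈-++⁺ˡ ∘ ∈-++⁺ˡ) Eg₀
        where
        xs-inst : NumInst σ[ 0 ∷ toList xs ] (vars₁ k) (toList xs)
        xs-inst = vars₁-inst 0 (toList xs) (length-toList xs)
        lhs-inst : NumInst σ[ 0 ∷ toList xs ] (zeroᵀ ∷ vars₁ k) (0 ∷ toList xs)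
        lhs-inst = refl ∷ xs-inst
      Eval⇒⟶* o g@(precF {k} g₀ h) g≤K@(_ , h≤K) g⊆R (ev-precS g₀ h n xs y z Eprev Eh) =
        root-step* (own⊆ o g g⊆R (there (here refl))) σ[ n ∷ toList xs ]
          (F-numInst _ lhs-inst) (F-inst _ rhs-inst)
        ◅◅ F-⟶* R (main (o + #syms g₀) h)
             (ε ∷ Eval⇒⟶* o g g≤K g⊆R Eprev ∷ Pointwise.refl ε {map ⌜_⌝ (toList xs)})
        ◅◅ Eval⇒⟶* (o + #syms g₀) h h≤K (g⊆R ∘ ∈-++⁺ˡ ∘ ∈-++⁺ʳ (rules o g₀)) Eh
        where
        xs-inst : NumInst σ[ n ∷ toList xs ] (vars₁ k) (toList xs)
        xs-inst = vars₁-inst n (toList xs) (length-toList xs)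
        lhs-inst : NumInst σ[ n ∷ toList xs ] (sucᵀ (var 0) ∷ vars₁ k) (suc n ∷ toList xs)
        lhs-inst = refl ∷ xs-inst
        M = main o g
        rhs-inst : Inst σ[ n ∷ toList xs ] (var 0 ∷ F M (vars (suc k)) ∷ vars₁ k)
                                            (⌜ n ⌝ ∷ F M (map ⌜_⌝ (n ∷ toList xs)) ∷ map ⌜_⌝ (toList xs))
        rhs-inst = refl ∷ F-numInst M (vars-inst (n ∷ toList xs) (cong suc (length-toList xs)) (λ _ _ → refl))
                        ∷ NumInst⇒Inst xs-inst

      EvalAll⇒⟶* : ∀ {k m} o (gs : Vec (MR k) m) → AritiesAtMost* K gs → rules* o gs ⊆ R →
                   ∀ {xs ys} → EvalAll gs xs ys →
                   Pointwise _⟶*_ (map (λ j → F j (map ⌜_⌝ (toList xs))) (mains o gs)) (map ⌜_⌝ (toList ys))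
      EvalAll⇒⟶* o []       _            gs⊆R ([] xs)   = []
      EvalAll⇒⟶* o (g ∷ gs) (g≤K , gs≤K) gs⊆R (Eg ∷ Egs) =
        Eval⇒⟶* o g g≤K (gs⊆R ∘ ∈-++⁺ˡ) Eg ∷ EvalAll⇒⟶* (o + #syms g) gs gs≤K (gs⊆R ∘ ∈-++⁺ʳ (rules o g)) Egs

  0<+ : ∀ {o} a → 0 < o → 0 < o + a
  0<+ a 0<o = ≤-trans 0<o (m≤m+n _ a)

  +-≤ˡ : ∀ o a b {n} → o + (a + b) ≤ n → o + a ≤ n
  +-≤ˡ o a b = ≤-trans (+-monoʳ-≤ o (m≤m+n a b))

  +-≤ʳ : ∀ o a b {n} → o + (a + b) ≤ n → o + a + b ≤ n
  +-≤ʳ o a b = ≤-trans (≤-reflexive (+-assoc o a b))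

  main≤ : ∀ {k n} o (g : MR k) → o + #syms g ≤ n → main o g ≤ n
  main≤ o g = ≤-trans (+-monoʳ-≤ o (n≤1+n _))

  mains< : ∀ {k n} o (gs : Vec (MR k) n) → All (_< o + #syms* gs) (mains o gs)
  mains< o []       = []
  mains< o (g ∷ gs) =
    +-monoʳ-< o (s≤s (m≤m+n (#subsyms g) (#syms* gs))) ∷
    All.map (λ {j} j< → subst (j <_) (+-assoc o (#syms g) (#syms* gs)) j<) (mains< (o + #syms g) gs)

  -- The own rules of a code call the symbols of its subcodes and A, all of lower rank, and
  -- a primitive recursion calls itself on a smaller first argument.
  ownRules-good : ∀ {k} o (g : MR k) → 0 < o → o + #syms g ≤ m → AritiesAtMost K g →
                  All GoodRule (ownRules o g)
  ownRules-good {k} o g@(zeroF _) _ _ k≤K = good (below-zero z<s) zero-vars ∷ []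
    where open Lhs (main o g) (vars k) (vars≤K k≤K)
  ownRules-good o g@succF _ _ _ =
    good (below-suc (s≤s (s≤s z≤n)) (var 0)) (suc-vars (var-vars (var-lhs (here refl)))) ∷ []
    where open Lhs (main o g) (vars 1) (s≤s z≤n)
  ownRules-good {k} o g@(projF i) _ _ k≤K = good (var _) (var-vars (var-lhs (var-∈-vars (toℕ<n i)))) ∷ []
    where open Lhs (main o g) (vars k) (vars≤K k≤K)
  ownRules-good {k} o g@(ackF _ _) 0<o g≤m k≤K =
    good (below-F 0 (symF-< (0<+ 0 0<o) (main≤ o g g≤m))
           (++⁺ (replicate⁺ (K ∸ k) (below-zero z<s)) (vars↓ k)))
         (F-vars 0 (++⁺ (zeros-vars (K ∸ k)) (vars-vars k (var-lhs ∘ var-∈-vars)))) ∷ []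
    where open Lhs (main o g) (vars k) (vars≤K k≤K)
  ownRules-good {k} o g@(compF h gs) _ g≤m (k≤K , _) =
    good (below-F (main o h) (symF-< (+-monoʳ-< o (s≤s (m≤m+n _ _))) M≤m)
           (map⁺ (All.map (λ j<M → below-F _ (symF-< j<M M≤m) (vars↓ k)) mains<M)))
         (F-vars _ (map⁺ (All.universal (λ j → F-vars j (vars-vars k (var-lhs ∘ var-∈-vars))) (mains o′ gs))))
    ∷ []
    where
    open Lhs (main o g) (vars k) (vars≤K k≤K)
    o′ = o + #syms h
    M≤m = main≤ o g g≤m
    mains<M : All (_< main o g) (mains o′ gs)
    mains<M = All.map (λ {j} j< → subst (j <_) (+-assoc o (#syms h) (#syms* gs)) j<) (mains< o′ gs)
  ownRules-good o g@(precF {k} g₀ h) _ g≤m g≤K = stop ∷ recurse ∷ []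
    where
    o′ = o + #syms g₀
    M = main o g
    M≤m = main≤ o g g≤m
    h<M : main o′ h < M
    h<M = subst (main o′ h <_) (+-assoc o (#syms g₀) (#syms h)) (+-monoʳ-< o′ ≤-refl)
    sk≤K : length (zeroᵀ ∷ vars₁ k) ≤ K
    sk≤K = subst (λ l → suc l ≤ K) (sym (length-applyUpTo _ k)) (arity≤ g g≤K)
    stop : GoodRule (F M (zeroᵀ ∷ vars₁ k) , F (main o g₀) (vars₁ k))
    stop = good (below-F (main o g₀) (symF-< (+-monoʳ-< o (s≤s (m≤m+n _ _))) M≤m) (vars₁↓ k))
                (F-vars _ (vars₁-vars k (λ x<k → var-lhs (there (var-∈-vars₁ x<k)))))
      where open Lhs M (zeroᵀ ∷ vars₁ k) sk≤K
    recurse : GoodRule (F M (sucᵀ (var 0) ∷ vars₁ k) , F (main o′ h) (var 0 ∷ F M (vars (suc k)) ∷ vars₁ k))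
    recurse = good (below-F (main o′ h) (symF-< h<M M≤m)
                     (var 0 ∷ below-same (lex-head (sucᵀ-⊳ (var 0))) (var 0 ∷ vars₁↓ k) ∷ vars₁↓ k))
                   (F-vars _ (var-vars 0-lhs ∷ F-vars M (var-vars 0-lhs ∷ xs-vars) ∷ xs-vars))
      where
      open Lhs M (sucᵀ (var 0) ∷ vars₁ k) sk≤K
      0-lhs = sucᵀ-var-lhs (here refl)
      xs-vars = vars₁-vars k (λ x<k → var-lhs (there (var-∈-vars₁ x<k)))

  mutual
    rules-good : ∀ {k} o (g : MR k) → 0 < o → o + #syms g ≤ m → AritiesAtMost K g →
                 All GoodRule (rules o g)
    rules-good o g 0<o g≤m g≤K =
      ++⁺ (subcodeRules-good o g 0<o g≤m g≤K) (ownRules-good o g 0<o g≤m g≤K)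

    subcodeRules-good : ∀ {k} o (g : MR k) → 0 < o → o + #syms g ≤ m → AritiesAtMost K g →
                        All GoodRule (subcodeRules o g)
    subcodeRules-good o (zeroF _)    _ _ _ = []
    subcodeRules-good o succF        _ _ _ = []
    subcodeRules-good o (projF _)    _ _ _ = []
    subcodeRules-good o (ackF _ _)   _ _ _ = []
    subcodeRules-good o g@(compF h gs) 0<o g≤m (_ , h≤K , gs≤K) =
      ++⁺ (rules-good o h 0<o (+-≤ˡ o _ _ (main≤ o g g≤m)) h≤K)
          (rules*-good (o + #syms h) gs (0<+ _ 0<o) (+-≤ʳ o _ _ (main≤ o g g≤m)) gs≤K)
    subcodeRules-good o g@(precF g₀ h) 0<o g≤m (g₀≤K , h≤K) =
      ++⁺ (rules-good o g₀ 0<o (+-≤ˡ o _ _ (main≤ o g g≤m)) g₀≤K)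
          (rules-good (o + #syms g₀) h (0<+ _ 0<o) (+-≤ʳ o _ _ (main≤ o g g≤m)) h≤K)

    rules*-good : ∀ {k n} o (gs : Vec (MR k) n) → 0 < o → o + #syms* gs ≤ m → AritiesAtMost* K gs →
                  All GoodRule (rules* o gs)
    rules*-good o []       _   _    _            = []
    rules*-good o (g ∷ gs) 0<o gs≤m (g≤K , gs≤K) =
      ++⁺ (rules-good o g 0<o (+-≤ˡ o _ _ gs≤m) g≤K)
          (rules*-good (o + #syms g) gs (0<+ _ 0<o) (+-≤ʳ o _ _ gs≤m) gs≤K)

-- The system for f

module System {k} (f : MR k) where

  B : ℕ
  B = maxArity f

  m : ℕ
  m = 3 + #syms f

  open Signature B m public
  open Ackermann B m hiding (module Evaluation) public
  open Compile B m public

  sucsᵀ : ℕ → Tm → Tm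
  sucsᵀ zero    t = t
  sucsᵀ (suc c) t = sucᵀ (sucsᵀ c t)

  -- Besides A = F₀ and the compiled code on F₃, …, F_(m-1): F₁ nondeterministically
  -- decreases its argument, F₂ counts its argument down to 0, and Fₘ starts f on
  -- arguments below the size of the start term.
  guess-step guess-stop countdown start : Rule Sg
  guess-step = F 1 (sucᵀ (var 0) ∷ []) , F 1 (var 0 ∷ [])
  guess-stop = F 1 (var 0 ∷ []) , var 0
  countdown  = F 2 (sucᵀ (var 0) ∷ []) , F 2 (var 0 ∷ [])
  start      = F m (var 0 ∷ []) ,
               F 2 (F (main 3 f) (replicate k (F 1 (sucsᵀ (suc K) (var 0) ∷ []))) ∷ [])

  R : List (Rule Sg)
  R = ackRules ++ guess-step ∷ guess-stop ∷ countdown ∷ start ∷ rules 3 f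

  f≤K : AritiesAtMost K f
  f≤K = maxArity⇒AritiesAtMost f (≤-trans (n≤1+n B) (n≤1+n (suc B)))

  open Rewriting R
  open Evaluation R (∈-++⁺ˡ)

  unary-inst : ∀ j t {x n} → t · σ[ x ∷ [] ] ≡ ⌜ n ⌝ → F j (t ∷ []) · σ[ x ∷ [] ] ≡ F j (⌜ n ⌝ ∷ [])
  unary-inst j t eq = F-numInst j {P = t ∷ []} (eq ∷ [])

  guess-⟶* : ∀ {x} n → x ≤ n → F 1 (⌜ n ⌝ ∷ []) ⟶* ⌜ x ⌝
  guess-⟶* n x≤n with m≤n⇒m<n∨m≡n x≤n
  ... | inj₂ refl =
    root-step* (∈-++⁺ʳ ackRules (there (here refl))) σ[ n ∷ [] ] (unary-inst 1 (var 0) refl) refl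
  guess-⟶* (suc n) _ | inj₁ (s≤s x≤n) =
    root-step* (∈-++⁺ʳ ackRules (here refl)) σ[ n ∷ [] ] (unary-inst 1 (sucᵀ (var 0)) {n = suc n} refl)
      (unary-inst 1 (var 0) refl)
    ◅◅ guess-⟶* n x≤n

  countdown-Steps : ∀ y → Steps R y (F 2 (⌜ y ⌝ ∷ [])) (F 2 (⌜ 0 ⌝ ∷ []))
  countdown-Steps zero    = done
  countdown-Steps (suc y) =
    next (root-step (∈-++⁺ʳ ackRules (there (there (here refl)))) σ[ y ∷ [] ]
            (unary-inst 2 (sucᵀ (var 0)) {n = suc y} refl) (unary-inst 2 (var 0) refl))
         (countdown-Steps y)

  size-⌜⌝ : ∀ x → size ⌜ x ⌝ ≡ suc x
  size-⌜⌝ zero    = refl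
  size-⌜⌝ (suc x) = cong suc (trans (+-identityʳ _) (size-⌜⌝ x))

  sizes-zeros : ∀ n → sizes (tabulate {n = n} (λ _ → zeroᵀ)) ≡ n
  sizes-zeros zero    = refl
  sizes-zeros (suc n) = cong suc (sizes-zeros n)

  size-start : ∀ c → size (F m (⌜ c ⌝ ∷ [])) ≡ c + suc K
  size-start c = begin
    suc (size ⌜ c ⌝ + sizes (tabulate {n = suc B} (λ _ → zeroᵀ)))
      ≡⟨ cong₂ (λ a b → suc (a + b)) (size-⌜⌝ c) (sizes-zeros (suc B)) ⟩
    suc (suc (c + suc B))
      ≡˘⟨ cong suc (+-suc c (suc B)) ⟩
    suc (c + suc (suc B))
      ≡˘⟨ +-suc c (suc (suc B)) ⟩
    c + suc K
      ∎
    where open ≡-Reasoning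

  sucsᵀ-inst : ∀ c x → sucsᵀ c (var 0) · σ[ x ∷ [] ] ≡ ⌜ c + x ⌝
  sucsᵀ-inst zero    x = refl
  sucsᵀ-inst (suc c) x = cong sucᵀ (sucsᵀ-inst c x)

  guesses-⟶* : ∀ {n k′} (xs : Vec ℕ k′) → All (_≤ n) (toList xs) →
            Pointwise _⟶*_ (replicate k′ (F 1 (⌜ n ⌝ ∷ []))) (map ⌜_⌝ (toList xs))
  guesses-⟶* []       []           = []
  guesses-⟶* (x ∷ xs) (x≤n ∷ xs≤n) = guess-⟶* _ x≤n ∷ guesses-⟶* xs xs≤n

  start-⟶* : ∀ n → suc K ≤ n → (xs : Vec ℕ k) → All (_≤ n) (toList xs) → ∀ {y} → Eval f xs y →
            F m (⌜ n ∸ suc K ⌝ ∷ []) ⟶* F 2 (⌜ y ⌝ ∷ [])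
  start-⟶* n K<n xs xs≤n E =
    root-step* (∈-++⁺ʳ ackRules (there (there (there (here refl))))) σ[ c ∷ [] ] (unary-inst m (var 0) refl)
      (F-inst 2 {P = F (main 3 f) (replicate k guesser) ∷ []}
         (F-inst (main 3 f) (Pointwise.replicate⁺ guesser-inst k) ∷ []))
    ◅◅ F-⟶* R 2 ((F-⟶* R (main 3 f) (guesses-⟶* xs xs≤n) ◅◅ Eval⇒⟶* 3 f f≤K f⊆R E) ∷ [])
    where
    c = n ∸ suc K
    guesser = F 1 (sucsᵀ (suc K) (var 0) ∷ [])
    guesser-inst : guesser · σ[ c ∷ [] ] ≡ F 1 (⌜ n ⌝ ∷ [])
    guesser-inst = unary-inst 1 (sucsᵀ (suc K) (var 0))
                     (trans (sucsᵀ-inst (suc K) c) (cong ⌜_⌝ (trans (+-comm (suc K) c) (m∸n+n≡m K<n))))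
    f⊆R : ∀ {ρ} → ρ ∈ rules 3 f → ρ ∈ R
    f⊆R = ∈-++⁺ʳ ackRules ∘ there ∘ there ∘ there ∘ there

  majorises : Majorises R f
  majorises = suc K , λ n K<n xs xs≤n y E →
    let (l , derivation) = ⟶*⇒Steps (start-⟶* n K<n xs xs≤n E)
    in  F m (⌜ n ∸ suc K ⌝ ∷ []) ,
        ≤-reflexive (trans (size-start (n ∸ suc K)) (m∸n+n≡m K<n)) ,
        Steps⇒DhAtLeast (Steps-++ derivation (countdown-Steps y)) y (m≤n+m y l)

  sucsᵀ↓ : ∀ {ts} c → RankLexBelow (symF m) ts (sucsᵀ c (var 0))
  sucsᵀ↓ zero    = var 0
  sucsᵀ↓ (suc c) = below-suc (s≤s (s≤s z≤n)) (sucsᵀ↓ c)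

  sucsᵀ-vars : ∀ {Q} c → Q 0 → VarsIn Q (sucsᵀ c (var 0))
  sucsᵀ-vars zero    q0 = var-vars q0
  sucsᵀ-vars (suc c) q0 = suc-vars (sucsᵀ-vars c q0)

  R-good : All GoodRule R
  R-good = ++⁺ ackRules-good (guess-step-good ∷ guess-stop-good ∷ countdown-good ∷ start-good ∷
                              rules-good 3 f (s≤s z≤n) ≤-refl f≤K)
    where
    guess-step-good : GoodRule guess-step
    guess-step-good = good (below-same (lex-head (sucᵀ-⊳ (var 0))) (var 0 ∷ []))
                           (F-vars 1 (var-vars (sucᵀ-var-lhs (here refl)) ∷ []))
      where open Lhs 1 (sucᵀ (var 0) ∷ []) (s≤s z≤n)
    guess-stop-good : GoodRule guess-stop
    guess-stop-good = good (var 0) (var-vars (var-lhs (here refl)))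
      where open Lhs 1 (var 0 ∷ []) (s≤s z≤n)
    countdown-good : GoodRule countdown
    countdown-good = good (below-same (lex-head (sucᵀ-⊳ (var 0))) (var 0 ∷ []))
                          (F-vars 2 (var-vars (sucᵀ-var-lhs (here refl)) ∷ []))
      where open Lhs 2 (sucᵀ (var 0) ∷ []) (s≤s z≤n)
    start-good : GoodRule start
    start-good =
      good (below-F 2 (symF-< (s≤s (s≤s (s≤s z≤n))) ≤-refl)
             (below-F (main 3 f) (symF-< ≤-refl ≤-refl)
               (replicate⁺ k (below-F 1 (symF-< (s≤s (s≤s z≤n)) ≤-refl) (sucsᵀ↓ (suc K) ∷ []))) ∷ []))
           (F-vars 2 (F-vars _ (replicate⁺ k (F-vars 1 (sucsᵀ-vars (suc K) (var-lhs (here refl)) ∷ []))) ∷ []))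
      where open Lhs m (var 0 ∷ []) (s≤s z≤n)

  isTRS : IsTRS R
  isTRS ρ∈R with All.lookup R-good ρ∈R
  ... | (_ , _ , refl , _) , r-vars = (λ x ()) , r-vars

  arity≤K : ∀ g → arity g ≤ K
  arity≤K zero          = z≤n
  arity≤K (suc zero)    = s≤s z≤n
  arity≤K (suc (suc _)) = ≤-refl

lemma1 : ∀ {k} (f : MR k) →
    Σ ℕ λ n → Σ (Fin n → ℕ) λ a → Σ (List (Rule (FinSig n a))) λ R →
      IsTRS R × Majorises R f × ProofTree R (DP R)
lemma1 f = N , arity , R , isTRS , majorises , rankLexProofTree R isTRS (proj₁ ∘ All.lookup R-good) K arity≤K
  where open System f
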